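{- (a) For every integer $n>4$ there exists a full amicable orthogonal design $$AOD\Big(2^n;\ 2^{n-3},2^{n-3},2^{n-3},10,10,5\cdot2^2,5\cdot 2^3,\ldots,5\cdot2^{n-4};\ 2^{n-3},2^{n-3},2^{n-3},5\cdot2^{n-3}\Big),$$ where the terms $5\cdot 2^j$ range over $2\le j\le n-4$ (none when $n=5$). (b) For every integer $n>3$ there exists a full amicable orthogonal design $$AOD\Big(3\cdot2^n;\ 2^{n-2},2^{n-2},2^{n-2},18,18,9\cdot2^2,9\cdot2^3,\ldots,9\cdot2^{n-3};\ 2^{n-2},2^{n-2},2^{n-2},9\cdot2^{n-2}\Big),$$ where the terms $9\cdot 2^j$ range over $2\le j\le n-3$ (none when $n=4$).
   Context: An orthogonal design (OD) of order $m$ and type $(c_1,\ldots,c_k)$ is a square matrix $C$ of order $m$ with entries from $\{0,\pm x_1,\ldots,\pm x_k\}$ ($x_j$ commuting variables) with $CC^{\rm T}=(\sum_j c_jx_j^2)I_m$; it is full if it has no zero entries. An amicable orthogonal design $AOD(m;\ c_1,\ldots,c_k;\ d_1,\ldots,d_\ell)$ is a pair $(C;D)$ where $C$ is an $OD(m;c_1,\ldots,c_k)$, $D$ is an $OD(m;d_1,\ldots,d_\ell)$, the variables of $C$ and $D$ are disjoint sets, and $CD^{\rm T}=DC^{\rm T}$; it is full if both $C$ and $D$ have no zero entries. -}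

module Defs where

open import Data.Nat using (ℕ; zero; suc; _+_; _*_; _∸_; _^_)
open import Data.Integer as ℤ using (ℤ; +_; -_)
open import Data.Fin using (Fin; _≟_)
open import Data.List using (List; []; _∷_; _++_; length; lookup; map; upTo)
open import Data.Maybe using (Maybe; just; nothing)
open import Data.Product using (_×_; _,_; Σ)
open import Relation.Nullary using (yes; no)
open import Relation.Binary.PropositionalEquality using (_≡_)

data Sign : Set where
  plus minus : Sign

sgn : Sign → ℤ
sgn plus  = + 1
sgn minus = - (+ 1)

-- An entry of a design with k variables: 0 or ± x_a with a : Fin k.
Entry : ℕ → Set
Entry k = Maybe (Sign × Fin k)

Design : ℕ → ℕ → Set
Design m k = Fin m → Fin m → Entry k

Σ[_] : ∀ {m} → (Fin m → ℤ) → ℤ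
Σ[_] {zero}  f = + 0
Σ[_] {suc m} f = f Fin.zero ℤ.+ Σ[_] (λ i → f (Fin.suc i))

coef : ∀ {k k'} → Entry k → Entry k' → Fin k → Fin k' → ℤ
coef (just (s , a')) (just (t , b')) a b with a' ≟ a | b' ≟ b
... | yes _ | yes _ = sgn s ℤ.* sgn t
... | _     | _     = + 0
coef _ _ _ _ = + 0

-- Coefficient of x_a·y_b in the (i,j) entry of C Dᵀ, read as an ordered
-- bilinear expression (x_a from C, y_b from D).
prodCoef : ∀ {m k k'} → Design m k → Design m k' →
           Fin m → Fin m → Fin k → Fin k' → ℤ
prodCoef C D i j a b = Σ[ (λ l → coef (C i l) (D j l) a b) ]

δ : ∀ {n} → Fin n → Fin n → ℤ
δ i j with i ≟ j
... | yes _ = + 1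
... | no  _ = + 0

-- C is an OD(m; c_1,...,c_k): C Cᵀ = (Σ c_a x_a²) I_m as polynomials in
-- commuting variables. Since variables commute, the coefficient of the
-- monomial x_a x_b in (C Cᵀ)_{ij} is P(a,b) + P(b,a) for a ≠ b and P(a,a)
-- for a = b, where P = prodCoef C C i j; we compare P(a,b)+P(b,a) (which is
-- twice the coefficient when a = b) against the same quantity for the target.
IsOD : ∀ m (cs : List ℕ) → Design m (length cs) → Set
IsOD m cs C = ∀ i j a b →
  prodCoef C C i j a b ℤ.+ prodCoef C C i j b a
    ≡ δ i j ℤ.* δ a b ℤ.* (+ 2 ℤ.* + (lookup cs a))

IsFull : ∀ {m k} → Design m k → Set
IsFull {m} {k} C = ∀ i j → Σ (Sign × Fin k) λ e → C i j ≡ just e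

-- Amicable: C Dᵀ = D Cᵀ; the variables of C (x's) and of D (y's) are disjoint,
-- so the coefficient of x_a y_b must agree on both sides.
IsAmicable : ∀ {m k l} → Design m k → Design m l → Set
IsAmicable C D = ∀ i j a b →
  prodCoef C D i j a b ≡ Σ[ (λ r → coef (C j r) (D i r) a b) ]

record FullAOD (m : ℕ) (cs ds : List ℕ) : Set where
  field
    C     : Design m (length cs)
    D     : Design m (length ds)
    C-od  : IsOD m cs C
    D-od  : IsOD m ds D
    amic  : IsAmicable C D
    C-full : IsFull C
    D-full : IsFull D

-- [b·2^2, b·2^3, ..., b·2^t]  (empty when t < 2)
geomTail : ℕ → ℕ → List ℕ
geomTail b t = map (λ j → b * 2 ^ j) (drop2 (upTo (suc t)))
  where
  drop2 : List ℕ → List ℕ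
  drop2 (_ ∷ _ ∷ xs) = xs
  drop2 _ = []

-- Write a design as Σₐ xₐ Aₐ with {0,±1} coefficient matrices Aₐ. Let (C; D) be a full
-- AOD of order m and (E; y F) one of order N whose second design has a single variable y.
-- Replacing one variable x_β of C by the design E and every other xₐ by xₐ F, and D by
-- D ⊗ F, gives a full AOD of order mN with weights cₐ f, c_β eₛ; d_b f. This follows from
-- the mixed-product property (X ⊗ Y)(X′ ⊗ Y′)ᵀ = X X′ᵀ ⊗ Y Y′ᵀ; the terms mixing x_β with
-- the other variables cancel since Aₐ A_βᵀ + A_β Aₐᵀ = 0 and F Eₛᵀ is symmetric (amicability).
-- Iterating with AOD(2; 1,1; 2) gives AOD(2^(t+1); 1,1,2,…,2^t; 2^(t+1)), and one more
-- product with an explicit AOD(16; 10,2,2,2; 2,2,2,10), resp. AOD(24; 18,2,2,2; 2,2,2,18),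
-- checked by evaluation, gives (a), resp. (b).

module Submission where

open import Defs
open import Data.Nat using (ℕ; _+_; _*_; _∸_; _^_; _>_)
open import Data.List using (List; []; _∷_; _++_)
open import Data.Product using (_×_)

open import Data.Fin using (Fin; zero; suc; toℕ; cast; _≟_; _↑ˡ_; _↑ʳ_; combine; quotient; remainder)
open import Data.Fin.Permutation using (cast-id)
open import Data.Fin.Properties
  using (all?; suc-injective; remQuot-combine; combine-remQuot; +↔⊎; toℕ-cast; toℕ-↑ˡ; toℕ-↑ʳ)
open import Data.Integer as ℤ using (ℤ; +_)
import Data.Integer.Properties as ℤP
open import Algebra.Properties.Semiring.Sum ℤP.+-*-semiring
  using (sum; sum-cong-≗; *-distribˡ-sum; *-distribʳ-sum)
open import Algebra.Properties.CommutativeSemigroup ℤP.*-commutativeSemigroup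
  using () renaming (interchange to *-interchange)
open import Data.Integer.Tactic.RingSolver using (solve-∀)
open import Data.List using (length; lookup; map; applyUpTo)
import Data.List.Properties as ListP
open import Data.Maybe using (just; nothing)
open import Data.Nat using (zero; suc; s≤s)
import Data.Nat.Properties as ℕP
open import Data.Product using (_,_; proj₁; proj₂; Σ)
open import Data.Sum using (_⊎_; inj₁; inj₂; [_,_]′)
open import Data.Sum.Properties using (inj₁-injective; inj₂-injective; swap-↔)
open import Data.Vec as Vec using (Vec; []; _∷_)
import Data.Vec.Properties as VecP
open import Function using (_∘_; _↔_; Inverse; case_of_)
open import Function.Definitions using (Injective)
open import Function.Properties.Inverse using (↔-trans)
open import Relation.Binary.PropositionalEquality
open import Relation.Nullary using (Dec; yes; no)
open import Relation.Nullary.Decidable using (True; toWitness; map′)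
open import Relation.Nullary.Negation using (contradiction)

open ≡-Reasoning

Σ≡sum : ∀ {n} (f : Fin n → ℤ) → Σ[ f ] ≡ sum f
Σ≡sum {zero}  f = refl
Σ≡sum {suc n} f = cong (ℤ._+_ (f zero)) (Σ≡sum (f ∘ suc))

sum-↑ : ∀ m {n} (f : Fin (m + n) → ℤ) →
        sum f ≡ sum (λ i → f (i ↑ˡ n)) ℤ.+ sum (λ j → f (m ↑ʳ j))
sum-↑ zero    f = sym (ℤP.+-identityˡ _)
sum-↑ (suc m) {n} f =
  trans (cong (ℤ._+_ (f zero)) (sum-↑ m (f ∘ suc)))
        (sym (ℤP.+-assoc (f zero) (sum (λ i → f (suc i ↑ˡ n))) (sum (λ j → f (suc m ↑ʳ j)))))

sum-combine : ∀ m {n} (f : Fin (m * n) → ℤ) →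
              sum f ≡ sum (λ i → sum (λ j → f (combine {m} {n} i j)))
sum-combine zero        f = refl
sum-combine (suc m) {n} f =
  trans (sum-↑ n f) (cong (ℤ._+_ (sum (λ j → f (j ↑ˡ m * n)))) (sum-combine m (f ∘ (n ↑ʳ_))))

sum-*-sum : ∀ {m n} (g : Fin m → ℤ) (h : Fin n → ℤ) →
            sum (λ i → sum (λ j → g i ℤ.* h j)) ≡ sum g ℤ.* sum h
sum-*-sum g h =
  trans (sum-cong-≗ (λ i → sym (*-distribˡ-sum (g i) h))) (sym (*-distribʳ-sum (sum h) g))

δ-refl : ∀ {n} (a : Fin n) → δ a a ≡ + 1
δ-refl a with a ≟ a
... | yes _  = refl
... | no a≢a = contradiction refl a≢a

δ-≢ : ∀ {n} {a b : Fin n} → a ≢ b → δ a b ≡ + 0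
δ-≢ {a = a} {b} a≢b with a ≟ b
... | yes a≡b = contradiction a≡b a≢b
... | no _    = refl

δ-injective : ∀ {m n} {f : Fin m → Fin n} → Injective _≡_ _≡_ f → ∀ a b → δ (f a) (f b) ≡ δ a b
δ-injective f-inj a b with a ≟ b
... | yes refl = δ-refl _
... | no a≢b   = δ-≢ (a≢b ∘ f-inj)

δ*δ≡0 : ∀ {m n} {a b : Fin m} {c d : Fin n} → a ≢ b ⊎ c ≢ d → δ a b ℤ.* δ c d ≡ + 0
δ*δ≡0 {c = c} {d} (inj₁ a≢b) = cong (ℤ._* δ c d) (δ-≢ a≢b)
δ*δ≡0 {a = a} {b} (inj₂ c≢d) = trans (cong (δ a b ℤ.*_) (δ-≢ c≢d)) (ℤP.*-zeroʳ (δ a b))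

Matrix : ℕ → ℕ → Set
Matrix m n = Fin m → Fin n → ℤ

infix 4 _≋_
_≋_ : ∀ {m n} → Matrix m n → Matrix m n → Set
X ≋ Y = ∀ i j → X i j ≡ Y i j

scalar : ∀ {n} → ℤ → Matrix n n
scalar κ i j = δ i j ℤ.* κ

IsSymmetric : ∀ {n} → Matrix n n → Set
IsSymmetric X = ∀ i j → X i j ≡ X j i

infixl 7 _·ᵀ_
_·ᵀ_ : ∀ {m m′ n} → Matrix m n → Matrix m′ n → Matrix m m′
(X ·ᵀ Y) i j = sum (λ l → X i l ℤ.* Y j l)

⟪_,_⟫ : ∀ {m n} → Matrix m n → Matrix m n → Matrix m m
⟪ X , Y ⟫ i j = (X ·ᵀ Y) i j ℤ.+ (Y ·ᵀ X) i j

-- Rows and columns of Fin (m * n) are read block-wise: quotient picks the block,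
-- remainder the position inside it.
infixl 7 _⊗_
_⊗_ : ∀ {m m′ n n′} → Matrix m m′ → Matrix n n′ → Matrix (m * n) (m′ * n′)
_⊗_ {m} {m′} {n} {n′} X Y w z =
  X (quotient {m} n w) (quotient {m′} n′ z) ℤ.* Y (remainder {m} n w) (remainder {m′} n′ z)

δ-⊗ : ∀ {m n} → δ ≋ δ {m} ⊗ δ {n}
δ-⊗ {m} {n} w z with w ≟ z
... | yes refl = sym (cong₂ ℤ._*_ (δ-refl (quotient {m} n w)) (δ-refl (remainder {m} n w)))
... | no w≢z   = sym (δ*δ≡0 quotient-or-remainder-≢)
  where
  quotient-or-remainder-≢ : quotient {m} n w ≢ quotient {m} n z ⊎ remainder {m} n w ≢ remainder {m} n z
  quotient-or-remainder-≢ with quotient {m} n w ≟ quotient {m} n z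
  ... | no q≢q′   = inj₁ q≢q′
  ... | yes q≡q′  = inj₂ λ r≡r′ → w≢z (begin
    w                                               ≡⟨ combine-remQuot {m} n w ⟨
    combine (quotient {m} n w) (remainder {m} n w)  ≡⟨ cong₂ combine q≡q′ r≡r′ ⟩
    combine (quotient {m} n z) (remainder {m} n z)  ≡⟨ combine-remQuot {m} n z ⟩
    z                                               ∎)

·ᵀ-cong : ∀ {m m′ n} {X X′ : Matrix m n} {Y Y′ : Matrix m′ n} → X ≋ X′ → Y ≋ Y′ → X ·ᵀ Y ≋ X′ ·ᵀ Y′
·ᵀ-cong X≋X′ Y≋Y′ i j = sum-cong-≗ (λ l → cong₂ ℤ._*_ (X≋X′ i l) (Y≋Y′ j l))

·ᵀ-transpose : ∀ {m m′ n} (X : Matrix m n) (Y : Matrix m′ n) i j → (X ·ᵀ Y) i j ≡ (Y ·ᵀ X) j i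
·ᵀ-transpose X Y i j = sum-cong-≗ (λ l → ℤP.*-comm (X i l) (Y j l))

⟪⟫-cong : ∀ {m n} {X X′ Y Y′ : Matrix m n} → X ≋ X′ → Y ≋ Y′ → ⟪ X , Y ⟫ ≋ ⟪ X′ , Y′ ⟫
⟪⟫-cong X≋X′ Y≋Y′ i j = cong₂ ℤ._+_ (·ᵀ-cong X≋X′ Y≋Y′ i j) (·ᵀ-cong Y≋Y′ X≋X′ i j)

⟪⟫-comm : ∀ {m n} (X Y : Matrix m n) → ⟪ X , Y ⟫ ≋ ⟪ Y , X ⟫
⟪⟫-comm X Y i j = ℤP.+-comm ((X ·ᵀ Y) i j) ((Y ·ᵀ X) i j)

⊗-cong : ∀ {m m′ n n′} {X X′ : Matrix m m′} {Y Y′ : Matrix n n′} → X ≋ X′ → Y ≋ Y′ → X ⊗ Y ≋ X′ ⊗ Y′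
⊗-cong X≋X′ Y≋Y′ w z = cong₂ ℤ._*_ (X≋X′ _ _) (Y≋Y′ _ _)

⊗-scalar : ∀ {m n} (κ μ : ℤ) → scalar {m} κ ⊗ scalar {n} μ ≋ scalar (κ ℤ.* μ)
⊗-scalar {m} {n} κ μ w z = begin
  δq ℤ.* κ ℤ.* (δr ℤ.* μ)  ≡⟨ *-interchange δq κ δr μ ⟩
  δq ℤ.* δr ℤ.* (κ ℤ.* μ)  ≡⟨ cong (ℤ._* (κ ℤ.* μ)) (δ-⊗ {m} {n} w z) ⟨
  δ w z ℤ.* (κ ℤ.* μ)      ∎
  where
  δq δr : ℤ
  δq = δ (quotient {m} n w) (quotient {m} n z)
  δr = δ (remainder {m} n w) (remainder {m} n z)

⊗-zeroˡ : ∀ {m m′ n n′} {X : Matrix m m′} (Y : Matrix n n′) → X ≋ (λ _ _ → + 0) → X ⊗ Y ≋ (λ _ _ → + 0)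
⊗-zeroˡ Y X≋0 w z = cong (ℤ._* _) (X≋0 _ _)

⊗-symmetric : ∀ {m n} {X : Matrix m m} {Y : Matrix n n} → IsSymmetric X → IsSymmetric Y → IsSymmetric (X ⊗ Y)
⊗-symmetric X-sym Y-sym w z = cong₂ ℤ._*_ (X-sym _ _) (Y-sym _ _)

symmetric-≋ : ∀ {n} {X Y : Matrix n n} → X ≋ Y → IsSymmetric Y → IsSymmetric X
symmetric-≋ X≋Y Y-sym i j = trans (X≋Y i j) (trans (Y-sym i j) (sym (X≋Y j i)))

⊗-combine : ∀ {m m′ n n′} (X : Matrix m m′) (Y : Matrix n n′) w j v →
            (X ⊗ Y) w (combine j v) ≡ X (quotient {m} n w) j ℤ.* Y (remainder {m} n w) v
⊗-combine {m} {n = n} {n′} X Y w j v =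
  cong₂ (λ j′ v′ → X (quotient {m} n w) j′ ℤ.* Y (remainder {m} n w) v′)
        (cong proj₁ (remQuot-combine j v)) (cong proj₂ (remQuot-combine j v))

⊗-·ᵀ : ∀ {m m′ n n′ p q} (X : Matrix m m′) (Y : Matrix n n′) (X′ : Matrix p m′) (Y′ : Matrix q n′) →
       (X ⊗ Y) ·ᵀ (X′ ⊗ Y′) ≋ (X ·ᵀ X′) ⊗ (Y ·ᵀ Y′)
⊗-·ᵀ {m} {m′} {n} {n′} {p} {q} X Y X′ Y′ w z = begin
  sum (λ l → (X ⊗ Y) w l ℤ.* (X′ ⊗ Y′) z l)
    ≡⟨ sum-combine m′ {n′} _ ⟩
  sum (λ j → sum (λ v → (X ⊗ Y) w (combine {m′} {n′} j v) ℤ.* (X′ ⊗ Y′) z (combine j v)))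
    ≡⟨ sum-cong-≗ (λ j → sum-cong-≗ (λ v → regroup j v)) ⟩
  sum (λ j → sum (λ v → X qw j ℤ.* X′ qz j ℤ.* (Y rw v ℤ.* Y′ rz v)))
    ≡⟨ sum-*-sum (λ j → X qw j ℤ.* X′ qz j) (λ v → Y rw v ℤ.* Y′ rz v) ⟩
  (X ·ᵀ X′) qw qz ℤ.* (Y ·ᵀ Y′) rw rz ∎
  where
  qw : Fin m
  qw = quotient {m} n w
  qz : Fin p
  qz = quotient {p} q z
  rw : Fin n
  rw = remainder {m} n w
  rz : Fin q
  rz = remainder {p} q z
  regroup : ∀ j v → (X ⊗ Y) w (combine {m′} {n′} j v) ℤ.* (X′ ⊗ Y′) z (combine j v)
                    ≡ X qw j ℤ.* X′ qz j ℤ.* (Y rw v ℤ.* Y′ rz v)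
  regroup j v = trans (cong₂ ℤ._*_ (⊗-combine X Y w j v) (⊗-combine X′ Y′ z j v))
                      (*-interchange (X qw j) (Y rw v) (X′ qz j) (Y′ rz v))

⟪⊗⟫-factorʳ : ∀ {m m′ n n′} (X X′ : Matrix m m′) (Y Y′ : Matrix n n′) →
              Y ·ᵀ Y′ ≋ Y′ ·ᵀ Y → ⟪ X ⊗ Y , X′ ⊗ Y′ ⟫ ≋ ⟪ X , X′ ⟫ ⊗ (Y ·ᵀ Y′)
⟪⊗⟫-factorʳ {m} {n = n} X X′ Y Y′ YY′≋Y′Y w z = begin
  ((X ⊗ Y) ·ᵀ (X′ ⊗ Y′)) w z ℤ.+ ((X′ ⊗ Y′) ·ᵀ (X ⊗ Y)) w z
    ≡⟨ cong₂ ℤ._+_ (⊗-·ᵀ X Y X′ Y′ w z) (⊗-·ᵀ X′ Y′ X Y w z) ⟩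
  (X ·ᵀ X′) qw qz ℤ.* (Y ·ᵀ Y′) rw rz ℤ.+ (X′ ·ᵀ X) qw qz ℤ.* (Y′ ·ᵀ Y) rw rz
    ≡⟨ cong (λ t → (X ·ᵀ X′) qw qz ℤ.* (Y ·ᵀ Y′) rw rz ℤ.+ (X′ ·ᵀ X) qw qz ℤ.* t) (YY′≋Y′Y rw rz) ⟨
  (X ·ᵀ X′) qw qz ℤ.* (Y ·ᵀ Y′) rw rz ℤ.+ (X′ ·ᵀ X) qw qz ℤ.* (Y ·ᵀ Y′) rw rz
    ≡⟨ ℤP.*-distribʳ-+ ((Y ·ᵀ Y′) rw rz) ((X ·ᵀ X′) qw qz) ((X′ ·ᵀ X) qw qz) ⟨
  ⟪ X , X′ ⟫ qw qz ℤ.* (Y ·ᵀ Y′) rw rz ∎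
  where
  qw qz : Fin m
  qw = quotient {m} n w
  qz = quotient {m} n z
  rw rz : Fin n
  rw = remainder {m} n w
  rz = remainder {m} n z

⟪⊗⟫-factorˡ : ∀ {m m′ n n′} (X X′ : Matrix m m′) (Y Y′ : Matrix n n′) →
              X ·ᵀ X′ ≋ X′ ·ᵀ X → ⟪ X ⊗ Y , X′ ⊗ Y′ ⟫ ≋ (X ·ᵀ X′) ⊗ ⟪ Y , Y′ ⟫
⟪⊗⟫-factorˡ {m} {n = n} X X′ Y Y′ XX′≋X′X w z = begin
  ((X ⊗ Y) ·ᵀ (X′ ⊗ Y′)) w z ℤ.+ ((X′ ⊗ Y′) ·ᵀ (X ⊗ Y)) w z
    ≡⟨ cong₂ ℤ._+_ (⊗-·ᵀ X Y X′ Y′ w z) (⊗-·ᵀ X′ Y′ X Y w z) ⟩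
  (X ·ᵀ X′) qw qz ℤ.* (Y ·ᵀ Y′) rw rz ℤ.+ (X′ ·ᵀ X) qw qz ℤ.* (Y′ ·ᵀ Y) rw rz
    ≡⟨ cong (λ t → (X ·ᵀ X′) qw qz ℤ.* (Y ·ᵀ Y′) rw rz ℤ.+ t ℤ.* (Y′ ·ᵀ Y) rw rz) (XX′≋X′X qw qz) ⟨
  (X ·ᵀ X′) qw qz ℤ.* (Y ·ᵀ Y′) rw rz ℤ.+ (X ·ᵀ X′) qw qz ℤ.* (Y′ ·ᵀ Y) rw rz
    ≡⟨ ℤP.*-distribˡ-+ ((X ·ᵀ X′) qw qz) ((Y ·ᵀ Y′) rw rz) ((Y′ ·ᵀ Y) rw rz) ⟨
  (X ·ᵀ X′) qw qz ℤ.* ⟪ Y , Y′ ⟫ rw rz ∎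
  where
  qw qz : Fin m
  qw = quotient {m} n w
  qz = quotient {m} n z
  rw rz : Fin n
  rw = remainder {m} n w
  rz = remainder {m} n z

entryCoef : ∀ {k} → Entry k → Fin k → ℤ
entryCoef nothing        _ = + 0
entryCoef (just (s , b)) a = sgn s ℤ.* δ b a

coefMatrix : ∀ {m k} → Design m k → Fin k → Matrix m m
coefMatrix C a i j = entryCoef (C i j) a

coef≡entryCoef* : ∀ {k k′} (e : Entry k) (e′ : Entry k′) a b → coef e e′ a b ≡ entryCoef e a ℤ.* entryCoef e′ b
coef≡entryCoef* nothing          e′               a b = refl
coef≡entryCoef* (just (s , a′))  nothing          a b = sym (ℤP.*-zeroʳ (sgn s ℤ.* δ a′ a))
coef≡entryCoef* (just (s , a′)) (just (t , b′)) a b with a′ ≟ a | b′ ≟ b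
... | yes _ | yes _ = sym (cong₂ ℤ._*_ (ℤP.*-identityʳ (sgn s)) (ℤP.*-identityʳ (sgn t)))
... | yes _ | no _  = sym (trans (cong (sgn s ℤ.* + 1 ℤ.*_) (ℤP.*-zeroʳ (sgn t))) (ℤP.*-zeroʳ (sgn s ℤ.* + 1)))
... | no _  | _     = sym (cong (ℤ._* _) (ℤP.*-zeroʳ (sgn s)))

prodCoef≡·ᵀ : ∀ {m k k′} (C : Design m k) (D : Design m k′) i j a b →
              prodCoef C D i j a b ≡ (coefMatrix C a ·ᵀ coefMatrix D b) i j
prodCoef≡·ᵀ C D i j a b =
  trans (Σ≡sum (λ l → coef (C i l) (D j l) a b)) (sum-cong-≗ (λ l → coef≡entryCoef* (C i l) (D j l) a b))

IsOD′ : ∀ m {k} → (Fin k → ℕ) → Design m k → Set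
IsOD′ m c C = ∀ i j a b →
  prodCoef C C i j a b ℤ.+ prodCoef C C i j b a ≡ δ i j ℤ.* δ a b ℤ.* (+ 2 ℤ.* + c a)

record FullAOD′ (m : ℕ) {k q : ℕ} (c : Fin k → ℕ) (d : Fin q → ℕ) : Set where
  field
    C      : Design m k
    D      : Design m q
    C-od   : IsOD′ m c C
    D-od   : IsOD′ m d D
    amic   : IsAmicable C D
    C-full : IsFull C
    D-full : IsFull D

odScalar : ∀ {k} → (Fin k → ℕ) → Fin k → Fin k → ℤ
odScalar c a b = δ a b ℤ.* (+ 2 ℤ.* + c a)

od⇒⟪⟫ : ∀ {m k} {c : Fin k → ℕ} {C : Design m k} → IsOD′ m c C →
        ∀ a b → ⟪ coefMatrix C a , coefMatrix C b ⟫ ≋ scalar (odScalar c a b)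
od⇒⟪⟫ {c = c} {C} od a b i j =
  trans (sym (cong₂ ℤ._+_ (prodCoef≡·ᵀ C C i j a b) (prodCoef≡·ᵀ C C i j b a)))
        (trans (od i j a b) (ℤP.*-assoc (δ i j) (δ a b) (+ 2 ℤ.* + c a)))

⟪⟫⇒od : ∀ {m k} {c : Fin k → ℕ} {C : Design m k} →
        (∀ a b → ⟪ coefMatrix C a , coefMatrix C b ⟫ ≋ scalar (odScalar c a b)) → IsOD′ m c C
⟪⟫⇒od {c = c} {C} h i j a b =
  trans (cong₂ ℤ._+_ (prodCoef≡·ᵀ C C i j a b) (prodCoef≡·ᵀ C C i j b a))
        (trans (h a b i j) (sym (ℤP.*-assoc (δ i j) (δ a b) (+ 2 ℤ.* + c a))))

od⇒·ᵀ-self : ∀ {m k} {c : Fin k → ℕ} {C : Design m k} → IsOD′ m c C →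
             ∀ a → coefMatrix C a ·ᵀ coefMatrix C a ≋ scalar (+ c a)
od⇒·ᵀ-self {c = c} {C} od a i j = ℤP.*-cancelˡ-≡ (+ 2) x (δ i j ℤ.* + c a) (begin
  + 2 ℤ.* x                             ≡⟨ double x ⟩
  x ℤ.+ x                               ≡⟨ od⇒⟪⟫ {c = c} {C} od a a i j ⟩
  δ i j ℤ.* (δ a a ℤ.* (+ 2 ℤ.* + c a))  ≡⟨ cong (λ t → δ i j ℤ.* (t ℤ.* (+ 2 ℤ.* + c a))) (δ-refl a) ⟩
  δ i j ℤ.* (+ 1 ℤ.* (+ 2 ℤ.* + c a))    ≡⟨ regroup (δ i j) (+ c a) ⟩
  + 2 ℤ.* (δ i j ℤ.* + c a)             ∎)
  where
  x : ℤ
  x = (coefMatrix C a ·ᵀ coefMatrix C a) i j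
  double : ∀ x → + 2 ℤ.* x ≡ x ℤ.+ x
  double = solve-∀
  regroup : ∀ d c → d ℤ.* (+ 1 ℤ.* (+ 2 ℤ.* c)) ≡ + 2 ℤ.* (d ℤ.* c)
  regroup = solve-∀

amicable⇒symmetric : ∀ {m k k′} {C : Design m k} {D : Design m k′} → IsAmicable C D →
                     ∀ a b → IsSymmetric (coefMatrix C a ·ᵀ coefMatrix D b)
amicable⇒symmetric {C = C} {D} amic a b i j =
  trans (sym (prodCoef≡·ᵀ C D i j a b)) (trans (amic i j a b) (prodCoef≡·ᵀ C D j i a b))

symmetric⇒amicable : ∀ {m k k′} {C : Design m k} {D : Design m k′} →
                     (∀ a b → IsSymmetric (coefMatrix C a ·ᵀ coefMatrix D b)) → IsAmicable C D
symmetric⇒amicable {C = C} {D} h i j a b =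
  trans (prodCoef≡·ᵀ C D i j a b) (trans (h a b i j) (sym (prodCoef≡·ᵀ C D j i a b)))

reweigh : ∀ {m k q} {c c′ : Fin k → ℕ} {d d′ : Fin q → ℕ} →
          (∀ a → c a ≡ c′ a) → (∀ b → d b ≡ d′ b) → FullAOD′ m c d → FullAOD′ m c′ d′
reweigh c≗c′ d≗d′ A = record
  { C = C ; D = D ; amic = amic ; C-full = C-full ; D-full = D-full
  ; C-od = λ i j a b → trans (C-od i j a b) (cong (λ t → δ i j ℤ.* δ a b ℤ.* (+ 2 ℤ.* + t)) (c≗c′ a))
  ; D-od = λ i j a b → trans (D-od i j a b) (cong (λ t → δ i j ℤ.* δ a b ℤ.* (+ 2 ℤ.* + t)) (d≗d′ a))
  }
  where open FullAOD′ A

toFullAOD : ∀ {m} {cs ds : List ℕ} → FullAOD′ m (lookup cs) (lookup ds) → FullAOD m cs ds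
toFullAOD A = record { C = C ; D = D ; C-od = C-od ; D-od = D-od ; amic = amic ; C-full = C-full ; D-full = D-full }
  where open FullAOD′ A

resize : ∀ {m m′ cs ds} → m ≡ m′ → FullAOD m cs ds → FullAOD m′ cs ds
resize refl A = A

-- The product construction

infixl 7 _·ˢ_
_·ˢ_ : Sign → Sign → Sign
plus  ·ˢ t     = t
minus ·ˢ plus  = minus
minus ·ˢ minus = plus

sgn-·ˢ : ∀ s t → sgn (s ·ˢ t) ≡ sgn s ℤ.* sgn t
sgn-·ˢ plus  plus  = refl
sgn-·ˢ plus  minus = refl
sgn-·ˢ minus plus  = refl
sgn-·ˢ minus minus = refl

-- Variable zero of A's first design is the one replaced by B's first design; σ identifies
-- the variables of the product with A's remaining variables ⊎ the variables of B's first design.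
module AODProduct {m N p q r k : ℕ} (σ : Fin k ↔ (Fin p ⊎ Fin r))
                  {c : Fin (suc p) → ℕ} {d : Fin q → ℕ} {e : Fin r → ℕ} {f : ℕ}
                  (A : FullAOD′ m c d) (B : FullAOD′ N e (λ (_ : Fin 1) → f)) where

  open Inverse σ using (to; from; strictlyInverseˡ; strictlyInverseʳ)
  module A = FullAOD′ A
  module B = FullAOD′ B

  from-injective : Injective _≡_ _≡_ from
  from-injective {u} {v} eq = trans (sym (strictlyInverseˡ u)) (trans (cong to eq) (strictlyInverseˡ v))

  δ-from₁ : ∀ a b → δ (from (inj₁ a)) (from (inj₁ b)) ≡ δ (suc a) (suc b)
  δ-from₁ a b = trans (δ-injective (inj₁-injective ∘ from-injective) a b) (sym (δ-injective suc-injective a b))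

  δ-from₂ : ∀ s s′ → δ (from (inj₂ s)) (from (inj₂ s′)) ≡ δ s s′
  δ-from₂ = δ-injective (inj₂-injective ∘ from-injective)

  δ-from₁₂ : ∀ a s → δ (from (inj₁ a)) (from (inj₂ s)) ≡ + 0
  δ-from₁₂ a s = δ-≢ (λ eq → case from-injective eq of λ ())

  δ-from₂₁ : ∀ s a → δ (from (inj₂ s)) (from (inj₁ a)) ≡ + 0
  δ-from₂₁ s a = δ-≢ (λ eq → case from-injective eq of λ ())

  productEntry : Entry (suc p) → Entry r → Entry 1 → Entry k
  productEntry (just (s , suc a)) _              (just (t , _)) = just (s ·ˢ t , from (inj₁ a))
  productEntry (just (s , zero))  (just (t , b)) _              = just (s ·ˢ t , from (inj₂ b))
  productEntry _                  _              _              = nothing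

  signedBy : Entry q → Entry 1 → Entry q
  signedBy (just (s , b)) (just (t , _)) = just (s ·ˢ t , b)
  signedBy _              _              = nothing

  outer : Fin (m * N) → Fin m
  outer = quotient {m} N

  inner : Fin (m * N) → Fin N
  inner = remainder {m} N

  C′ : Design (m * N) k
  C′ w z = productEntry (A.C (outer w) (outer z)) (B.C (inner w) (inner z)) (B.D (inner w) (inner z))

  D′ : Design (m * N) q
  D′ w z = signedBy (A.D (outer w) (outer z)) (B.D (inner w) (inner z))

  c′ : Fin k → ℕ
  c′ x = [ (λ a → c (suc a) * f) , (λ s → c zero * e s) ]′ (to x)

  d′ : Fin q → ℕ
  d′ b = d b * f

  private
    zero-middle : ∀ x y → x ℤ.* + 0 ℤ.* y ≡ + 0
    zero-middle = solve-∀
    one-middle : ∀ x y → x ℤ.* y ≡ x ℤ.* + 1 ℤ.* y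
    one-middle = solve-∀
    swap-middle : ∀ x y z → x ℤ.* y ℤ.* z ≡ x ℤ.* z ℤ.* (y ℤ.* + 1)
    swap-middle = solve-∀

  entryCoef-from₁ : ∀ eA eC eF a →
    entryCoef (productEntry eA eC eF) (from (inj₁ a)) ≡ entryCoef eA (suc a) ℤ.* entryCoef eF zero
  entryCoef-from₁ (just (s , suc a′)) eC (just (t , zero)) a = begin
    sgn (s ·ˢ t) ℤ.* δ (from (inj₁ a′)) (from (inj₁ a))   ≡⟨ cong₂ ℤ._*_ (sgn-·ˢ s t) (δ-from₁ a′ a) ⟩
    sgn s ℤ.* sgn t ℤ.* δ (suc a′) (suc a)               ≡⟨ swap-middle (sgn s) (sgn t) (δ (suc a′) (suc a)) ⟩
    sgn s ℤ.* δ (suc a′) (suc a) ℤ.* (sgn t ℤ.* + 1)     ∎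
  entryCoef-from₁ (just (s , suc a′)) eC nothing a = sym (ℤP.*-zeroʳ (sgn s ℤ.* δ (suc a′) (suc a)))
  entryCoef-from₁ (just (s , zero)) (just (t , b)) eF a =
    trans (trans (cong (sgn (s ·ˢ t) ℤ.*_) (δ-from₂₁ b a)) (ℤP.*-zeroʳ (sgn (s ·ˢ t))))
          (sym (zero-middle (sgn s) (entryCoef eF zero)))
  entryCoef-from₁ (just (s , zero)) nothing eF a = sym (zero-middle (sgn s) (entryCoef eF zero))
  entryCoef-from₁ nothing eC eF a = refl

  entryCoef-from₂ : ∀ eA eC eF s →
    entryCoef (productEntry eA eC eF) (from (inj₂ s)) ≡ entryCoef eA zero ℤ.* entryCoef eC s
  entryCoef-from₂ (just (s , suc a)) eC (just (t , zero)) s′ =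
    trans (trans (cong (sgn (s ·ˢ t) ℤ.*_) (δ-from₁₂ a s′)) (ℤP.*-zeroʳ (sgn (s ·ˢ t))))
          (sym (zero-middle (sgn s) (entryCoef eC s′)))
  entryCoef-from₂ (just (s , suc a)) eC nothing s′ = sym (zero-middle (sgn s) (entryCoef eC s′))
  entryCoef-from₂ (just (s , zero)) (just (t , b)) eF s′ = begin
    sgn (s ·ˢ t) ℤ.* δ (from (inj₂ b)) (from (inj₂ s′))  ≡⟨ cong₂ ℤ._*_ (sgn-·ˢ s t) (δ-from₂ b s′) ⟩
    sgn s ℤ.* sgn t ℤ.* δ b s′                          ≡⟨ ℤP.*-assoc (sgn s) (sgn t) (δ b s′) ⟩
    sgn s ℤ.* (sgn t ℤ.* δ b s′)                        ≡⟨ one-middle (sgn s) (sgn t ℤ.* δ b s′) ⟩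
    sgn s ℤ.* + 1 ℤ.* (sgn t ℤ.* δ b s′)                ∎
  entryCoef-from₂ (just (s , zero)) nothing eF s′ = sym (ℤP.*-zeroʳ (sgn s ℤ.* + 1))
  entryCoef-from₂ nothing eC eF s′ = refl

  entryCoef-signedBy : ∀ eD eF b → entryCoef (signedBy eD eF) b ≡ entryCoef eD b ℤ.* entryCoef eF zero
  entryCoef-signedBy (just (s , b′)) (just (t , zero)) b =
    trans (cong (ℤ._* δ b′ b) (sgn-·ˢ s t)) (swap-middle (sgn s) (sgn t) (δ b′ b))
  entryCoef-signedBy (just (s , b′)) nothing b = sym (ℤP.*-zeroʳ (sgn s ℤ.* δ b′ b))
  entryCoef-signedBy nothing eF b = refl

  Aᶜ : Fin (suc p) → Matrix m m
  Aᶜ = coefMatrix A.C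

  Aᵈ : Fin q → Matrix m m
  Aᵈ = coefMatrix A.D

  Bᶜ : Fin r → Matrix N N
  Bᶜ = coefMatrix B.C

  F : Matrix N N
  F = coefMatrix B.D zero

  C′-from₁ : ∀ a → coefMatrix C′ (from (inj₁ a)) ≋ Aᶜ (suc a) ⊗ F
  C′-from₁ a w z = entryCoef-from₁ (A.C (outer w) (outer z)) (B.C (inner w) (inner z)) (B.D (inner w) (inner z)) a

  C′-from₂ : ∀ s → coefMatrix C′ (from (inj₂ s)) ≋ Aᶜ zero ⊗ Bᶜ s
  C′-from₂ s w z = entryCoef-from₂ (A.C (outer w) (outer z)) (B.C (inner w) (inner z)) (B.D (inner w) (inner z)) s

  D′-coef : ∀ b → coefMatrix D′ b ≋ Aᵈ b ⊗ F
  D′-coef b w z = entryCoef-signedBy (A.D (outer w) (outer z)) (B.D (inner w) (inner z)) b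

  F·ᵀF : F ·ᵀ F ≋ scalar (+ f)
  F·ᵀF = od⇒·ᵀ-self {c = λ _ → f} {B.D} B.D-od zero

  Aᶜ₀·ᵀAᶜ₀ : Aᶜ zero ·ᵀ Aᶜ zero ≋ scalar (+ c zero)
  Aᶜ₀·ᵀAᶜ₀ = od⇒·ᵀ-self {c = c} {A.C} A.C-od zero

  -- This is what makes the cross terms of C′ cancel.
  F·ᵀBᶜ : ∀ s → F ·ᵀ Bᶜ s ≋ Bᶜ s ·ᵀ F
  F·ᵀBᶜ s u v = trans (·ᵀ-transpose F (Bᶜ s) u v) (amicable⇒symmetric {C = B.C} {B.D} B.amic s zero v u)

  c′-from : ∀ u → c′ (from u) ≡ [ (λ a → c (suc a) * f) , (λ s → c zero * e s) ]′ u
  c′-from u = cong [ (λ a → c (suc a) * f) , (λ s → c zero * e s) ]′ (strictlyInverseˡ u)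

  private
    regroup : ∀ d x y → d ℤ.* (+ 2 ℤ.* x) ℤ.* y ≡ d ℤ.* (+ 2 ℤ.* (x ℤ.* y))
    regroup = solve-∀
    regroup′ : ∀ d x y → x ℤ.* (d ℤ.* (+ 2 ℤ.* y)) ≡ d ℤ.* (+ 2 ℤ.* (x ℤ.* y))
    regroup′ = solve-∀

  ⟪⊗F,⊗F⟫ : ∀ (X X′ : Matrix m m) (κ : ℤ) (w : ℕ) → ⟪ X , X′ ⟫ ≋ scalar (κ ℤ.* (+ 2 ℤ.* + w)) →
             ⟪ X ⊗ F , X′ ⊗ F ⟫ ≋ scalar (κ ℤ.* (+ 2 ℤ.* + (w * f)))
  ⟪⊗F,⊗F⟫ X X′ κ w′ XX′-scalar w z = begin
    ⟪ X ⊗ F , X′ ⊗ F ⟫ w z                               ≡⟨ ⟪⊗⟫-factorʳ X X′ F F (λ _ _ → refl) w z ⟩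
    (⟪ X , X′ ⟫ ⊗ (F ·ᵀ F)) w z                          ≡⟨ ⊗-cong XX′-scalar F·ᵀF w z ⟩
    (scalar {m} (κ ℤ.* (+ 2 ℤ.* + w′)) ⊗ scalar {N} (+ f)) w z ≡⟨ ⊗-scalar {m} {N} (κ ℤ.* (+ 2 ℤ.* + w′)) (+ f) w z ⟩
    δ w z ℤ.* (κ ℤ.* (+ 2 ℤ.* + w′) ℤ.* + f)            ≡⟨ cong (δ w z ℤ.*_) (regroup κ (+ w′) (+ f)) ⟩
    δ w z ℤ.* (κ ℤ.* (+ 2 ℤ.* (+ w′ ℤ.* + f)))          ≡⟨ cong (λ t → δ w z ℤ.* (κ ℤ.* (+ 2 ℤ.* t))) (ℤP.pos-* w′ f) ⟨
    δ w z ℤ.* (κ ℤ.* (+ 2 ℤ.* + (w′ * f)))              ∎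

  odScalar-≢ : ∀ {x y} → δ x y ≡ + 0 → scalar {m * N} (odScalar c′ x y) ≋ (λ _ _ → + 0)
  odScalar-≢ {x} δxy≡0 w z = trans (cong (λ δ′ → δ w z ℤ.* (δ′ ℤ.* (+ 2 ℤ.* + c′ x))) δxy≡0) (ℤP.*-zeroʳ (δ w z))

  C′-⟪⟫ : ∀ u v → ⟪ coefMatrix C′ (from u) , coefMatrix C′ (from v) ⟫ ≋ scalar (odScalar c′ (from u) (from v))
  C′-⟪⟫ (inj₁ a) (inj₁ b) w z = begin
    ⟪ coefMatrix C′ (from (inj₁ a)) , coefMatrix C′ (from (inj₁ b)) ⟫ w z
      ≡⟨ ⟪⟫-cong (C′-from₁ a) (C′-from₁ b) w z ⟩
    ⟪ Aᶜ (suc a) ⊗ F , Aᶜ (suc b) ⊗ F ⟫ w z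
      ≡⟨ ⟪⊗F,⊗F⟫ (Aᶜ (suc a)) (Aᶜ (suc b)) (δ (suc a) (suc b)) (c (suc a)) (od⇒⟪⟫ {c = c} {A.C} A.C-od (suc a) (suc b)) w z ⟩
    δ w z ℤ.* (δ (suc a) (suc b) ℤ.* (+ 2 ℤ.* + (c (suc a) * f)))
      ≡⟨ cong₂ (λ δ′ t → δ w z ℤ.* (δ′ ℤ.* (+ 2 ℤ.* + t))) (δ-from₁ a b) (c′-from (inj₁ a)) ⟨
    δ w z ℤ.* odScalar c′ (from (inj₁ a)) (from (inj₁ b)) ∎
  C′-⟪⟫ (inj₂ s) (inj₂ s′) w z = begin
    ⟪ coefMatrix C′ (from (inj₂ s)) , coefMatrix C′ (from (inj₂ s′)) ⟫ w z
      ≡⟨ ⟪⟫-cong (C′-from₂ s) (C′-from₂ s′) w z ⟩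
    ⟪ Aᶜ zero ⊗ Bᶜ s , Aᶜ zero ⊗ Bᶜ s′ ⟫ w z
      ≡⟨ ⟪⊗⟫-factorˡ (Aᶜ zero) (Aᶜ zero) (Bᶜ s) (Bᶜ s′) (λ _ _ → refl) w z ⟩
    ((Aᶜ zero ·ᵀ Aᶜ zero) ⊗ ⟪ Bᶜ s , Bᶜ s′ ⟫) w z
      ≡⟨ ⊗-cong Aᶜ₀·ᵀAᶜ₀ (od⇒⟪⟫ {c = e} {B.C} B.C-od s s′) w z ⟩
    (scalar {m} (+ c zero) ⊗ scalar {N} (odScalar e s s′)) w z
      ≡⟨ ⊗-scalar {m} {N} (+ c zero) (odScalar e s s′) w z ⟩
    δ w z ℤ.* (+ c zero ℤ.* (δ s s′ ℤ.* (+ 2 ℤ.* + e s)))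
      ≡⟨ cong (δ w z ℤ.*_) (regroup′ (δ s s′) (+ c zero) (+ e s)) ⟩
    δ w z ℤ.* (δ s s′ ℤ.* (+ 2 ℤ.* (+ c zero ℤ.* + e s)))
      ≡⟨ cong (λ t → δ w z ℤ.* (δ s s′ ℤ.* (+ 2 ℤ.* t))) (ℤP.pos-* (c zero) (e s)) ⟨
    δ w z ℤ.* (δ s s′ ℤ.* (+ 2 ℤ.* + (c zero * e s)))
      ≡⟨ cong₂ (λ δ′ t → δ w z ℤ.* (δ′ ℤ.* (+ 2 ℤ.* + t))) (δ-from₂ s s′) (c′-from (inj₂ s)) ⟨
    δ w z ℤ.* odScalar c′ (from (inj₂ s)) (from (inj₂ s′)) ∎
  C′-⟪⟫ (inj₁ a) (inj₂ s) w z = begin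
    ⟪ coefMatrix C′ (from (inj₁ a)) , coefMatrix C′ (from (inj₂ s)) ⟫ w z
      ≡⟨ ⟪⟫-cong (C′-from₁ a) (C′-from₂ s) w z ⟩
    ⟪ Aᶜ (suc a) ⊗ F , Aᶜ zero ⊗ Bᶜ s ⟫ w z
      ≡⟨ ⟪⊗⟫-factorʳ (Aᶜ (suc a)) (Aᶜ zero) F (Bᶜ s) (F·ᵀBᶜ s) w z ⟩
    (⟪ Aᶜ (suc a) , Aᶜ zero ⟫ ⊗ (F ·ᵀ Bᶜ s)) w z
      ≡⟨ ⊗-zeroˡ (F ·ᵀ Bᶜ s) anticommute w z ⟩
    + 0
      ≡⟨ odScalar-≢ (δ-from₁₂ a s) w z ⟨
    δ w z ℤ.* odScalar c′ (from (inj₁ a)) (from (inj₂ s)) ∎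
    where
    anticommute : ⟪ Aᶜ (suc a) , Aᶜ zero ⟫ ≋ (λ _ _ → + 0)
    anticommute i j = trans (od⇒⟪⟫ {c = c} {A.C} A.C-od (suc a) zero i j) (ℤP.*-zeroʳ (δ i j))
  C′-⟪⟫ (inj₂ s) (inj₁ a) w z = begin
    ⟪ coefMatrix C′ (from (inj₂ s)) , coefMatrix C′ (from (inj₁ a)) ⟫ w z
      ≡⟨ ⟪⟫-comm (coefMatrix C′ (from (inj₂ s))) (coefMatrix C′ (from (inj₁ a))) w z ⟩
    ⟪ coefMatrix C′ (from (inj₁ a)) , coefMatrix C′ (from (inj₂ s)) ⟫ w z
      ≡⟨ C′-⟪⟫ (inj₁ a) (inj₂ s) w z ⟩
    δ w z ℤ.* odScalar c′ (from (inj₁ a)) (from (inj₂ s))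
      ≡⟨ odScalar-≢ (δ-from₁₂ a s) w z ⟩
    + 0
      ≡⟨ odScalar-≢ (δ-from₂₁ s a) w z ⟨
    δ w z ℤ.* odScalar c′ (from (inj₂ s)) (from (inj₁ a)) ∎

  D′-⟪⟫ : ∀ b b′ → ⟪ coefMatrix D′ b , coefMatrix D′ b′ ⟫ ≋ scalar (odScalar d′ b b′)
  D′-⟪⟫ b b′ w z = begin
    ⟪ coefMatrix D′ b , coefMatrix D′ b′ ⟫ w z  ≡⟨ ⟪⟫-cong (D′-coef b) (D′-coef b′) w z ⟩
    ⟪ Aᵈ b ⊗ F , Aᵈ b′ ⊗ F ⟫ w z              ≡⟨ ⟪⊗F,⊗F⟫ (Aᵈ b) (Aᵈ b′) (δ b b′) (d b) (od⇒⟪⟫ {c = d} {A.D} A.D-od b b′) w z ⟩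
    δ w z ℤ.* odScalar d′ b b′                ∎

  C′D′-symmetric : ∀ u b → IsSymmetric (coefMatrix C′ (from u) ·ᵀ coefMatrix D′ b)
  C′D′-symmetric (inj₁ a) b =
    symmetric-≋ (λ w z → trans (·ᵀ-cong (C′-from₁ a) (D′-coef b) w z) (⊗-·ᵀ (Aᶜ (suc a)) F (Aᵈ b) F w z))
                (⊗-symmetric (amicable⇒symmetric {C = A.C} {A.D} A.amic (suc a) b) (·ᵀ-transpose F F))
  C′D′-symmetric (inj₂ s) b =
    symmetric-≋ (λ w z → trans (·ᵀ-cong (C′-from₂ s) (D′-coef b) w z) (⊗-·ᵀ (Aᶜ zero) (Bᶜ s) (Aᵈ b) F w z))
                (⊗-symmetric (amicable⇒symmetric {C = A.C} {A.D} A.amic zero b)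
                             (amicable⇒symmetric {C = B.C} {B.D} B.amic s zero))

  viaFrom : ∀ {ℓ} (P : Fin k → Set ℓ) → (∀ u → P (from u)) → ∀ x → P x
  viaFrom P h x = subst P (strictlyInverseʳ x) (h (to x))

  productEntry-just : ∀ {eA eC eF} →
    Σ _ (λ x → eA ≡ just x) → Σ _ (λ x → eC ≡ just x) → Σ _ (λ x → eF ≡ just x) →
    Σ _ (λ x → productEntry eA eC eF ≡ just x)
  productEntry-just ((s , suc a) , refl) _                 ((t , _) , refl) = _ , refl
  productEntry-just ((s , zero)  , refl) ((t , b) , refl) _                 = _ , refl

  signedBy-just : ∀ {eD eF} → Σ _ (λ x → eD ≡ just x) → Σ _ (λ x → eF ≡ just x) → Σ _ (λ x → signedBy eD eF ≡ just x)
  signedBy-just ((s , b) , refl) ((t , _) , refl) = _ , refl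

  product : FullAOD′ (m * N) c′ d′
  product = record
    { C      = C′
    ; D      = D′
    ; C-od   = ⟪⟫⇒od {c = c′} {C′} λ x y →
                 viaFrom (λ x → ⟪ coefMatrix C′ x , coefMatrix C′ y ⟫ ≋ scalar (odScalar c′ x y))
                   (λ u → viaFrom (λ y → ⟪ coefMatrix C′ (from u) , coefMatrix C′ y ⟫ ≋ scalar (odScalar c′ (from u) y))
                            (C′-⟪⟫ u) y) x
    ; D-od   = ⟪⟫⇒od {c = d′} {D′} D′-⟪⟫
    ; amic   = symmetric⇒amicable {C = C′} {D′} λ x b →
                 viaFrom (λ x → IsSymmetric (coefMatrix C′ x ·ᵀ coefMatrix D′ b)) (λ u → C′D′-symmetric u b) x
    ; C-full = λ w z → productEntry-just (A.C-full (outer w) (outer z)) (B.C-full (inner w) (inner z))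
                                         (B.D-full (inner w) (inner z))
    ; D-full = λ w z → signedBy-just (A.D-full (outer w) (outer z)) (B.D-full (inner w) (inner z))
    }

  aodProduct : ∀ {c″ : Fin k → ℕ} {d″ : Fin q → ℕ} →
               (∀ a → c (suc a) * f ≡ c″ (from (inj₁ a))) → (∀ s → c zero * e s ≡ c″ (from (inj₂ s))) →
               (∀ b → d b * f ≡ d″ b) → FullAOD′ (m * N) c″ d″
  aodProduct {c″} c″-from₁ c″-from₂ d′≗d″ = reweigh c′≗c″ d′≗d″ product
    where
    c′≗c″ : ∀ x → c′ x ≡ c″ x
    c′≗c″ = viaFrom (λ x → c′ x ≡ c″ x) λ where
      (inj₁ a) → trans (c′-from (inj₁ a)) (c″-from₁ a)
      (inj₂ s) → trans (c′-from (inj₂ s)) (c″-from₂ s)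

open AODProduct public using (aodProduct)

-- Deciding the defining properties by evaluation

CoefTable : ℕ → ℕ → Set
CoefTable k k′ = Vec (Vec ℤ k′) k

_⟦_,_⟧ : ∀ {k k′} → CoefTable k k′ → Fin k → Fin k′ → ℤ
T ⟦ a , b ⟧ = Vec.lookup (Vec.lookup T a) b

addMonomial : ∀ {k k′} → Entry k → Entry k′ → CoefTable k k′ → CoefTable k k′
addMonomial (just (s , a)) (just (t , b)) T = T Vec.[ a ]%= (Vec._[ b ]%= ℤ._+_ (sgn s ℤ.* sgn t))
addMonomial _              _              T = T

-- Collects every coefficient of a product of two rows in a single pass, so that the
-- decisions below scan each pair of rows only once.
rowProductTable : ∀ {n k k′} → (Fin n → Entry k) → (Fin n → Entry k′) → CoefTable k k′
rowProductTable {zero}  x y = Vec.replicate _ (Vec.replicate _ (+ 0))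
rowProductTable {suc n} x y = addMonomial (x zero) (y zero) (rowProductTable (x ∘ suc) (y ∘ suc))

addMonomial-⟦⟧ : ∀ {k k′} (e : Entry k) (e′ : Entry k′) T a b →
                 addMonomial e e′ T ⟦ a , b ⟧ ≡ coef e e′ a b ℤ.+ T ⟦ a , b ⟧
addMonomial-⟦⟧ nothing         e′               T a b = sym (ℤP.+-identityˡ _)
addMonomial-⟦⟧ (just _)        nothing          T a b = sym (ℤP.+-identityˡ _)
addMonomial-⟦⟧ (just (s , a′)) (just (t , b′)) T a b with a′ ≟ a | b′ ≟ b
... | yes refl | yes refl =
  trans (cong (λ row → Vec.lookup row b′) (VecP.lookup∘updateAt a′ T))
        (VecP.lookup∘updateAt b′ (Vec.lookup T a′))
... | yes refl | no b′≢b =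
  trans (cong (λ row → Vec.lookup row b) (VecP.lookup∘updateAt a′ T))
        (trans (VecP.lookup∘updateAt′ b b′ (b′≢b ∘ sym) (Vec.lookup T a′)) (sym (ℤP.+-identityˡ _)))
... | no a′≢a  | _ =
  trans (cong (λ row → Vec.lookup row b) (VecP.lookup∘updateAt′ a a′ (a′≢a ∘ sym) T)) (sym (ℤP.+-identityˡ _))

rowProductTable-⟦⟧ : ∀ {n k k′} (x : Fin n → Entry k) (y : Fin n → Entry k′) a b →
                     rowProductTable x y ⟦ a , b ⟧ ≡ Σ[ (λ l → coef (x l) (y l) a b) ]
rowProductTable-⟦⟧ {zero}  x y a b =
  trans (cong (λ row → Vec.lookup row b) (VecP.lookup-replicate a _)) (VecP.lookup-replicate b _)
rowProductTable-⟦⟧ {suc n} x y a b =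
  trans (addMonomial-⟦⟧ (x zero) (y zero) _ a b)
        (cong (ℤ._+_ (coef (x zero) (y zero) a b)) (rowProductTable-⟦⟧ (x ∘ suc) (y ∘ suc) a b))

isOD′? : ∀ {m k} (c : Fin k → ℕ) (C : Design m k) → Dec (IsOD′ m c C)
isOD′? c C = all? λ i → all? λ j → rowPair? i j (rowProductTable (C i) (C j)) (rowProductTable-⟦⟧ (C i) (C j))
  where
  rowPair? : ∀ i j (T : CoefTable _ _) → (∀ a b → T ⟦ a , b ⟧ ≡ prodCoef C C i j a b) →
             Dec (∀ a b → prodCoef C C i j a b ℤ.+ prodCoef C C i j b a ≡ δ i j ℤ.* δ a b ℤ.* (+ 2 ℤ.* + c a))
  rowPair? i j T T≡ = all? λ a → all? λ b →
    map′ (trans (sym (cong₂ ℤ._+_ (T≡ a b) (T≡ b a)))) (trans (cong₂ ℤ._+_ (T≡ a b) (T≡ b a)))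
         (T ⟦ a , b ⟧ ℤ.+ T ⟦ b , a ⟧ ℤ.≟ δ i j ℤ.* δ a b ℤ.* (+ 2 ℤ.* + c a))

isAmicable? : ∀ {m k k′} (C : Design m k) (D : Design m k′) → Dec (IsAmicable C D)
isAmicable? C D = all? λ i → all? λ j →
  rowPair? i j (rowProductTable (C i) (D j)) (rowProductTable (C j) (D i))
           (rowProductTable-⟦⟧ (C i) (D j)) (rowProductTable-⟦⟧ (C j) (D i))
  where
  rowPair? : ∀ i j (T T′ : CoefTable _ _) →
             (∀ a b → T ⟦ a , b ⟧ ≡ prodCoef C D i j a b) → (∀ a b → T′ ⟦ a , b ⟧ ≡ prodCoef C D j i a b) →
             Dec (∀ a b → prodCoef C D i j a b ≡ prodCoef C D j i a b)
  rowPair? i j T T′ T≡ T′≡ = all? λ a → all? λ b →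
    map′ (λ eq → trans (sym (T≡ a b)) (trans eq (T′≡ a b))) (λ eq → trans (T≡ a b) (trans eq (sym (T′≡ a b))))
         (T ⟦ a , b ⟧ ℤ.≟ T′ ⟦ a , b ⟧)

isFull? : ∀ {m k} (C : Design m k) → Dec (IsFull C)
isFull? C = all? λ i → all? λ j → isJust? (C i j)
  where
  isJust? : ∀ {k} (e : Entry k) → Dec (Σ (Sign × Fin k) λ x → e ≡ just x)
  isJust? nothing  = no λ ()
  isJust? (just x) = yes (x , refl)

fullAOD′-byEvaluation :
  ∀ {m k q} (c : Fin k → ℕ) (d : Fin q → ℕ) (C : Design m k) (D : Design m q) →
  {True (isOD′? c C)} → {True (isOD′? d D)} → {True (isAmicable? C D)} → {True (isFull? C)} → {True (isFull? D)} →
  FullAOD′ m c d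
fullAOD′-byEvaluation c d C D {C-od} {D-od} {amic} {C-full} {D-full} = record
  { C = C ; D = D ; C-od = toWitness C-od ; D-od = toWitness D-od ; amic = toWitness amic
  ; C-full = toWitness C-full ; D-full = toWitness D-full }

-- The doubling family

doublingWeight : ℕ → ℕ
doublingWeight zero    = 1
doublingWeight (suc j) = 2 ^ j

C₂ : Design 2 2
C₂ zero       zero       = just (plus  , suc zero)
C₂ zero       (suc zero) = just (plus  , zero)
C₂ (suc zero) zero       = just (minus , zero)
C₂ (suc zero) (suc zero) = just (plus  , suc zero)

D₂ : Design 2 1
D₂ (suc zero) (suc zero) = just (minus , zero)
D₂ _          _          = just (plus  , zero)

aod₂ : FullAOD′ 2 (doublingWeight ∘ toℕ) (λ (_ : Fin 1) → 2)
aod₂ = fullAOD′-byEvaluation _ _ C₂ D₂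

lastVariable : ∀ r → Fin (suc r) ↔ (Fin 1 ⊎ Fin r)
lastVariable r = ↔-trans (cast-id (ℕP.+-comm 1 r)) (↔-trans (+↔⊎ {r} {1}) swap-↔)

toℕ-lastVariable₁ : ∀ r → toℕ (Inverse.from (lastVariable r) (inj₁ zero)) ≡ r
toℕ-lastVariable₁ r = trans (toℕ-cast _ (r ↑ʳ zero)) (trans (toℕ-↑ʳ r zero) (ℕP.+-identityʳ r))

toℕ-lastVariable₂ : ∀ r (s : Fin r) → toℕ (Inverse.from (lastVariable r) (inj₂ s)) ≡ toℕ s
toℕ-lastVariable₂ r s = trans (toℕ-cast _ (s ↑ˡ 1)) (toℕ-↑ˡ s 1)

doublingAOD : ∀ t → FullAOD′ (2 ^ suc t) (doublingWeight ∘ toℕ) (λ (_ : Fin 1) → 2 ^ suc t)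
doublingAOD zero    = aod₂
doublingAOD (suc t) = aodProduct σ aod₂ (doublingAOD t) newWeight oldWeights (λ _ → refl)
  where
  σ : Fin (3 + t) ↔ (Fin 1 ⊎ Fin (2 + t))
  σ = lastVariable (2 + t)

  newWeight : ∀ a → doublingWeight (toℕ (suc a)) * 2 ^ suc t ≡ doublingWeight (toℕ (Inverse.from σ (inj₁ a)))
  newWeight zero = trans (ℕP.*-identityˡ _) (sym (cong doublingWeight (toℕ-lastVariable₁ (2 + t))))

  oldWeights : ∀ s → 1 * doublingWeight (toℕ s) ≡ doublingWeight (toℕ (Inverse.from σ (inj₂ s)))
  oldWeights s = trans (ℕP.*-identityˡ _) (sym (cong doublingWeight (toℕ-lastVariable₂ (2 + t) s)))

-- The designs of orders 16 and 24

fromRows : ∀ {m k} → Vec (Vec (Entry k) m) m → Design m k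
fromRows rows i j = Vec.lookup (Vec.lookup rows i) j

+x₀ +x₁ +x₂ +x₃ -x₀ -x₁ -x₂ -x₃ : Entry 4
+x₀ = just (plus , zero)
+x₁ = just (plus , suc zero)
+x₂ = just (plus , suc (suc zero))
+x₃ = just (plus , suc (suc (suc zero)))
-x₀ = just (minus , zero)
-x₁ = just (minus , suc zero)
-x₂ = just (minus , suc (suc zero))
-x₃ = just (minus , suc (suc (suc zero)))

-- The weight-10 (resp. 18) variable of C is listed first, as the product construction
-- expects of the variable to be substituted.
C₁₆ : Design 16 4
C₁₆ = fromRows (
    (+x₁ ∷ +x₂ ∷ +x₃ ∷ -x₀ ∷ -x₀ ∷ -x₀ ∷ +x₀ ∷ -x₀ ∷ +x₁ ∷ +x₂ ∷ +x₃ ∷ -x₀ ∷ -x₀ ∷ -x₀ ∷ +x₀ ∷ -x₀ ∷ [])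
    ∷ (-x₂ ∷ +x₁ ∷ -x₀ ∷ -x₃ ∷ -x₀ ∷ +x₀ ∷ -x₀ ∷ -x₀ ∷ -x₂ ∷ +x₁ ∷ -x₀ ∷ -x₃ ∷ -x₀ ∷ +x₀ ∷ -x₀ ∷ -x₀ ∷ [])
    ∷ (-x₃ ∷ +x₀ ∷ +x₁ ∷ +x₂ ∷ +x₀ ∷ +x₀ ∷ +x₀ ∷ -x₀ ∷ -x₃ ∷ +x₀ ∷ +x₁ ∷ +x₂ ∷ +x₀ ∷ +x₀ ∷ +x₀ ∷ -x₀ ∷ [])
    ∷ (+x₀ ∷ +x₃ ∷ -x₂ ∷ +x₁ ∷ +x₀ ∷ -x₀ ∷ -x₀ ∷ -x₀ ∷ +x₀ ∷ +x₃ ∷ -x₂ ∷ +x₁ ∷ +x₀ ∷ -x₀ ∷ -x₀ ∷ -x₀ ∷ [])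
    ∷ (+x₀ ∷ +x₀ ∷ -x₀ ∷ -x₀ ∷ +x₁ ∷ +x₂ ∷ +x₃ ∷ +x₀ ∷ +x₀ ∷ +x₀ ∷ -x₀ ∷ -x₀ ∷ +x₁ ∷ +x₂ ∷ +x₃ ∷ +x₀ ∷ [])
    ∷ (+x₀ ∷ -x₀ ∷ -x₀ ∷ +x₀ ∷ -x₂ ∷ +x₁ ∷ +x₀ ∷ -x₃ ∷ +x₀ ∷ -x₀ ∷ -x₀ ∷ +x₀ ∷ -x₂ ∷ +x₁ ∷ +x₀ ∷ -x₃ ∷ [])
    ∷ (-x₀ ∷ +x₀ ∷ -x₀ ∷ +x₀ ∷ -x₃ ∷ -x₀ ∷ +x₁ ∷ +x₂ ∷ -x₀ ∷ +x₀ ∷ -x₀ ∷ +x₀ ∷ -x₃ ∷ -x₀ ∷ +x₁ ∷ +x₂ ∷ [])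
    ∷ (+x₀ ∷ +x₀ ∷ +x₀ ∷ +x₀ ∷ -x₀ ∷ +x₃ ∷ -x₂ ∷ +x₁ ∷ +x₀ ∷ +x₀ ∷ +x₀ ∷ +x₀ ∷ -x₀ ∷ +x₃ ∷ -x₂ ∷ +x₁ ∷ [])
    ∷ (+x₁ ∷ -x₂ ∷ +x₃ ∷ -x₀ ∷ -x₀ ∷ -x₀ ∷ +x₀ ∷ -x₀ ∷ -x₁ ∷ +x₂ ∷ -x₃ ∷ +x₀ ∷ +x₀ ∷ +x₀ ∷ -x₀ ∷ +x₀ ∷ [])
    ∷ (+x₂ ∷ +x₁ ∷ -x₀ ∷ -x₃ ∷ -x₀ ∷ +x₀ ∷ -x₀ ∷ -x₀ ∷ -x₂ ∷ -x₁ ∷ +x₀ ∷ +x₃ ∷ +x₀ ∷ -x₀ ∷ +x₀ ∷ +x₀ ∷ [])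
    ∷ (-x₃ ∷ +x₀ ∷ +x₁ ∷ -x₂ ∷ +x₀ ∷ +x₀ ∷ +x₀ ∷ -x₀ ∷ +x₃ ∷ -x₀ ∷ -x₁ ∷ +x₂ ∷ -x₀ ∷ -x₀ ∷ -x₀ ∷ +x₀ ∷ [])
    ∷ (+x₀ ∷ +x₃ ∷ +x₂ ∷ +x₁ ∷ +x₀ ∷ -x₀ ∷ -x₀ ∷ -x₀ ∷ -x₀ ∷ -x₃ ∷ -x₂ ∷ -x₁ ∷ -x₀ ∷ +x₀ ∷ +x₀ ∷ +x₀ ∷ [])
    ∷ (+x₀ ∷ +x₀ ∷ -x₀ ∷ -x₀ ∷ +x₁ ∷ -x₂ ∷ +x₃ ∷ +x₀ ∷ -x₀ ∷ -x₀ ∷ +x₀ ∷ +x₀ ∷ -x₁ ∷ +x₂ ∷ -x₃ ∷ -x₀ ∷ [])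
    ∷ (+x₀ ∷ -x₀ ∷ -x₀ ∷ +x₀ ∷ +x₂ ∷ +x₁ ∷ +x₀ ∷ -x₃ ∷ -x₀ ∷ +x₀ ∷ +x₀ ∷ -x₀ ∷ -x₂ ∷ -x₁ ∷ -x₀ ∷ +x₃ ∷ [])
    ∷ (-x₀ ∷ +x₀ ∷ -x₀ ∷ +x₀ ∷ -x₃ ∷ -x₀ ∷ +x₁ ∷ -x₂ ∷ +x₀ ∷ -x₀ ∷ +x₀ ∷ -x₀ ∷ +x₃ ∷ +x₀ ∷ -x₁ ∷ +x₂ ∷ [])
    ∷ (+x₀ ∷ +x₀ ∷ +x₀ ∷ +x₀ ∷ -x₀ ∷ +x₃ ∷ +x₂ ∷ +x₁ ∷ -x₀ ∷ -x₀ ∷ -x₀ ∷ -x₀ ∷ +x₀ ∷ -x₃ ∷ -x₂ ∷ -x₁ ∷ [])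
    ∷ [])

D₁₆ : Design 16 4
D₁₆ = fromRows (
    (+x₁ ∷ +x₀ ∷ +x₂ ∷ +x₃ ∷ +x₃ ∷ +x₃ ∷ -x₃ ∷ +x₃ ∷ -x₁ ∷ -x₀ ∷ -x₂ ∷ -x₃ ∷ -x₃ ∷ -x₃ ∷ +x₃ ∷ -x₃ ∷ [])
    ∷ (-x₀ ∷ +x₁ ∷ -x₃ ∷ +x₂ ∷ -x₃ ∷ +x₃ ∷ -x₃ ∷ -x₃ ∷ +x₀ ∷ -x₁ ∷ +x₃ ∷ -x₂ ∷ +x₃ ∷ -x₃ ∷ +x₃ ∷ +x₃ ∷ [])
    ∷ (+x₂ ∷ -x₃ ∷ -x₁ ∷ +x₀ ∷ -x₃ ∷ -x₃ ∷ -x₃ ∷ +x₃ ∷ -x₂ ∷ +x₃ ∷ +x₁ ∷ -x₀ ∷ +x₃ ∷ +x₃ ∷ +x₃ ∷ -x₃ ∷ [])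
    ∷ (+x₃ ∷ +x₂ ∷ -x₀ ∷ -x₁ ∷ +x₃ ∷ -x₃ ∷ -x₃ ∷ -x₃ ∷ -x₃ ∷ -x₂ ∷ +x₀ ∷ +x₁ ∷ -x₃ ∷ +x₃ ∷ +x₃ ∷ +x₃ ∷ [])
    ∷ (+x₃ ∷ -x₃ ∷ -x₃ ∷ +x₃ ∷ +x₂ ∷ +x₀ ∷ +x₃ ∷ -x₁ ∷ -x₃ ∷ +x₃ ∷ +x₃ ∷ -x₃ ∷ -x₂ ∷ -x₀ ∷ -x₃ ∷ +x₁ ∷ [])
    ∷ (+x₃ ∷ +x₃ ∷ -x₃ ∷ -x₃ ∷ -x₀ ∷ +x₂ ∷ +x₁ ∷ +x₃ ∷ -x₃ ∷ -x₃ ∷ +x₃ ∷ +x₃ ∷ +x₀ ∷ -x₂ ∷ -x₁ ∷ -x₃ ∷ [])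
    ∷ (-x₃ ∷ -x₃ ∷ -x₃ ∷ -x₃ ∷ +x₃ ∷ +x₁ ∷ -x₂ ∷ +x₀ ∷ +x₃ ∷ +x₃ ∷ +x₃ ∷ +x₃ ∷ -x₃ ∷ -x₁ ∷ +x₂ ∷ -x₀ ∷ [])
    ∷ (+x₃ ∷ -x₃ ∷ +x₃ ∷ -x₃ ∷ -x₁ ∷ +x₃ ∷ -x₀ ∷ -x₂ ∷ -x₃ ∷ +x₃ ∷ -x₃ ∷ +x₃ ∷ +x₁ ∷ -x₃ ∷ +x₀ ∷ +x₂ ∷ [])
    ∷ (+x₁ ∷ -x₀ ∷ +x₂ ∷ +x₃ ∷ +x₃ ∷ +x₃ ∷ -x₃ ∷ +x₃ ∷ +x₁ ∷ -x₀ ∷ +x₂ ∷ +x₃ ∷ +x₃ ∷ +x₃ ∷ -x₃ ∷ +x₃ ∷ [])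
    ∷ (+x₀ ∷ +x₁ ∷ -x₃ ∷ +x₂ ∷ -x₃ ∷ +x₃ ∷ -x₃ ∷ -x₃ ∷ +x₀ ∷ +x₁ ∷ -x₃ ∷ +x₂ ∷ -x₃ ∷ +x₃ ∷ -x₃ ∷ -x₃ ∷ [])
    ∷ (+x₂ ∷ -x₃ ∷ -x₁ ∷ -x₀ ∷ -x₃ ∷ -x₃ ∷ -x₃ ∷ +x₃ ∷ +x₂ ∷ -x₃ ∷ -x₁ ∷ -x₀ ∷ -x₃ ∷ -x₃ ∷ -x₃ ∷ +x₃ ∷ [])
    ∷ (+x₃ ∷ +x₂ ∷ +x₀ ∷ -x₁ ∷ +x₃ ∷ -x₃ ∷ -x₃ ∷ -x₃ ∷ +x₃ ∷ +x₂ ∷ +x₀ ∷ -x₁ ∷ +x₃ ∷ -x₃ ∷ -x₃ ∷ -x₃ ∷ [])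
    ∷ (+x₃ ∷ -x₃ ∷ -x₃ ∷ +x₃ ∷ +x₂ ∷ -x₀ ∷ +x₃ ∷ -x₁ ∷ +x₃ ∷ -x₃ ∷ -x₃ ∷ +x₃ ∷ +x₂ ∷ -x₀ ∷ +x₃ ∷ -x₁ ∷ [])
    ∷ (+x₃ ∷ +x₃ ∷ -x₃ ∷ -x₃ ∷ +x₀ ∷ +x₂ ∷ +x₁ ∷ +x₃ ∷ +x₃ ∷ +x₃ ∷ -x₃ ∷ -x₃ ∷ +x₀ ∷ +x₂ ∷ +x₁ ∷ +x₃ ∷ [])
    ∷ (-x₃ ∷ -x₃ ∷ -x₃ ∷ -x₃ ∷ +x₃ ∷ +x₁ ∷ -x₂ ∷ -x₀ ∷ -x₃ ∷ -x₃ ∷ -x₃ ∷ -x₃ ∷ +x₃ ∷ +x₁ ∷ -x₂ ∷ -x₀ ∷ [])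
    ∷ (+x₃ ∷ -x₃ ∷ +x₃ ∷ -x₃ ∷ -x₁ ∷ +x₃ ∷ +x₀ ∷ -x₂ ∷ +x₃ ∷ -x₃ ∷ +x₃ ∷ -x₃ ∷ -x₁ ∷ +x₃ ∷ +x₀ ∷ -x₂ ∷ [])
    ∷ [])

C₂₄ : Design 24 4
C₂₄ = fromRows (
    (+x₁ ∷ -x₂ ∷ -x₃ ∷ -x₀ ∷ +x₀ ∷ +x₀ ∷ +x₀ ∷ +x₀ ∷ -x₀ ∷ -x₀ ∷ +x₀ ∷ -x₀ ∷ +x₁ ∷ -x₂ ∷ -x₃ ∷ -x₀ ∷ +x₀ ∷ +x₀ ∷ +x₀ ∷ +x₀ ∷ -x₀ ∷ -x₀ ∷ +x₀ ∷ -x₀ ∷ [])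
    ∷ (+x₂ ∷ +x₁ ∷ -x₀ ∷ +x₃ ∷ +x₀ ∷ -x₀ ∷ +x₀ ∷ -x₀ ∷ -x₀ ∷ +x₀ ∷ -x₀ ∷ -x₀ ∷ +x₂ ∷ +x₁ ∷ -x₀ ∷ +x₃ ∷ +x₀ ∷ -x₀ ∷ +x₀ ∷ -x₀ ∷ -x₀ ∷ +x₀ ∷ -x₀ ∷ -x₀ ∷ [])
    ∷ (+x₃ ∷ +x₀ ∷ +x₁ ∷ -x₂ ∷ +x₀ ∷ -x₀ ∷ -x₀ ∷ +x₀ ∷ +x₀ ∷ +x₀ ∷ +x₀ ∷ -x₀ ∷ +x₃ ∷ +x₀ ∷ +x₁ ∷ -x₂ ∷ +x₀ ∷ -x₀ ∷ -x₀ ∷ +x₀ ∷ +x₀ ∷ +x₀ ∷ +x₀ ∷ -x₀ ∷ [])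
    ∷ (+x₀ ∷ -x₃ ∷ +x₂ ∷ +x₁ ∷ -x₀ ∷ -x₀ ∷ +x₀ ∷ +x₀ ∷ +x₀ ∷ -x₀ ∷ -x₀ ∷ -x₀ ∷ +x₀ ∷ -x₃ ∷ +x₂ ∷ +x₁ ∷ -x₀ ∷ -x₀ ∷ +x₀ ∷ +x₀ ∷ +x₀ ∷ -x₀ ∷ -x₀ ∷ -x₀ ∷ [])
    ∷ (-x₀ ∷ -x₀ ∷ -x₀ ∷ +x₀ ∷ +x₁ ∷ -x₂ ∷ -x₃ ∷ -x₀ ∷ +x₀ ∷ -x₀ ∷ +x₀ ∷ -x₀ ∷ -x₀ ∷ -x₀ ∷ -x₀ ∷ +x₀ ∷ +x₁ ∷ -x₂ ∷ -x₃ ∷ -x₀ ∷ +x₀ ∷ -x₀ ∷ +x₀ ∷ -x₀ ∷ [])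
    ∷ (-x₀ ∷ +x₀ ∷ +x₀ ∷ +x₀ ∷ +x₂ ∷ +x₁ ∷ -x₀ ∷ +x₃ ∷ -x₀ ∷ -x₀ ∷ -x₀ ∷ -x₀ ∷ -x₀ ∷ +x₀ ∷ +x₀ ∷ +x₀ ∷ +x₂ ∷ +x₁ ∷ -x₀ ∷ +x₃ ∷ -x₀ ∷ -x₀ ∷ -x₀ ∷ -x₀ ∷ [])
    ∷ (-x₀ ∷ -x₀ ∷ +x₀ ∷ -x₀ ∷ +x₃ ∷ +x₀ ∷ +x₁ ∷ -x₂ ∷ +x₀ ∷ +x₀ ∷ -x₀ ∷ -x₀ ∷ -x₀ ∷ -x₀ ∷ +x₀ ∷ -x₀ ∷ +x₃ ∷ +x₀ ∷ +x₁ ∷ -x₂ ∷ +x₀ ∷ +x₀ ∷ -x₀ ∷ -x₀ ∷ [])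
    ∷ (-x₀ ∷ +x₀ ∷ -x₀ ∷ -x₀ ∷ +x₀ ∷ -x₃ ∷ +x₂ ∷ +x₁ ∷ +x₀ ∷ -x₀ ∷ -x₀ ∷ +x₀ ∷ -x₀ ∷ +x₀ ∷ -x₀ ∷ -x₀ ∷ +x₀ ∷ -x₃ ∷ +x₂ ∷ +x₁ ∷ +x₀ ∷ -x₀ ∷ -x₀ ∷ +x₀ ∷ [])
    ∷ (+x₀ ∷ +x₀ ∷ -x₀ ∷ -x₀ ∷ -x₀ ∷ +x₀ ∷ -x₀ ∷ -x₀ ∷ +x₁ ∷ -x₂ ∷ -x₃ ∷ -x₀ ∷ +x₀ ∷ +x₀ ∷ -x₀ ∷ -x₀ ∷ -x₀ ∷ +x₀ ∷ -x₀ ∷ -x₀ ∷ +x₁ ∷ -x₂ ∷ -x₃ ∷ -x₀ ∷ [])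
    ∷ (+x₀ ∷ -x₀ ∷ -x₀ ∷ +x₀ ∷ +x₀ ∷ +x₀ ∷ -x₀ ∷ +x₀ ∷ +x₂ ∷ +x₁ ∷ -x₀ ∷ +x₃ ∷ +x₀ ∷ -x₀ ∷ -x₀ ∷ +x₀ ∷ +x₀ ∷ +x₀ ∷ -x₀ ∷ +x₀ ∷ +x₂ ∷ +x₁ ∷ -x₀ ∷ +x₃ ∷ [])
    ∷ (-x₀ ∷ +x₀ ∷ -x₀ ∷ +x₀ ∷ -x₀ ∷ +x₀ ∷ +x₀ ∷ +x₀ ∷ +x₃ ∷ +x₀ ∷ +x₁ ∷ -x₂ ∷ -x₀ ∷ +x₀ ∷ -x₀ ∷ +x₀ ∷ -x₀ ∷ +x₀ ∷ +x₀ ∷ +x₀ ∷ +x₃ ∷ +x₀ ∷ +x₁ ∷ -x₂ ∷ [])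
    ∷ (+x₀ ∷ +x₀ ∷ +x₀ ∷ +x₀ ∷ +x₀ ∷ +x₀ ∷ +x₀ ∷ -x₀ ∷ +x₀ ∷ -x₃ ∷ +x₂ ∷ +x₁ ∷ +x₀ ∷ +x₀ ∷ +x₀ ∷ +x₀ ∷ +x₀ ∷ +x₀ ∷ +x₀ ∷ -x₀ ∷ +x₀ ∷ -x₃ ∷ +x₂ ∷ +x₁ ∷ [])
    ∷ (+x₁ ∷ -x₂ ∷ -x₃ ∷ +x₀ ∷ -x₀ ∷ -x₀ ∷ -x₀ ∷ -x₀ ∷ +x₀ ∷ +x₀ ∷ -x₀ ∷ +x₀ ∷ -x₁ ∷ +x₂ ∷ +x₃ ∷ -x₀ ∷ +x₀ ∷ +x₀ ∷ +x₀ ∷ +x₀ ∷ -x₀ ∷ -x₀ ∷ +x₀ ∷ -x₀ ∷ [])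
    ∷ (+x₂ ∷ +x₁ ∷ +x₀ ∷ +x₃ ∷ -x₀ ∷ +x₀ ∷ -x₀ ∷ +x₀ ∷ +x₀ ∷ -x₀ ∷ +x₀ ∷ +x₀ ∷ -x₂ ∷ -x₁ ∷ -x₀ ∷ -x₃ ∷ +x₀ ∷ -x₀ ∷ +x₀ ∷ -x₀ ∷ -x₀ ∷ +x₀ ∷ -x₀ ∷ -x₀ ∷ [])
    ∷ (+x₃ ∷ -x₀ ∷ +x₁ ∷ -x₂ ∷ -x₀ ∷ +x₀ ∷ +x₀ ∷ -x₀ ∷ -x₀ ∷ -x₀ ∷ -x₀ ∷ +x₀ ∷ -x₃ ∷ +x₀ ∷ -x₁ ∷ +x₂ ∷ +x₀ ∷ -x₀ ∷ -x₀ ∷ +x₀ ∷ +x₀ ∷ +x₀ ∷ +x₀ ∷ -x₀ ∷ [])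
    ∷ (-x₀ ∷ -x₃ ∷ +x₂ ∷ +x₁ ∷ +x₀ ∷ +x₀ ∷ -x₀ ∷ -x₀ ∷ -x₀ ∷ +x₀ ∷ +x₀ ∷ +x₀ ∷ +x₀ ∷ +x₃ ∷ -x₂ ∷ -x₁ ∷ -x₀ ∷ -x₀ ∷ +x₀ ∷ +x₀ ∷ +x₀ ∷ -x₀ ∷ -x₀ ∷ -x₀ ∷ [])
    ∷ (+x₀ ∷ +x₀ ∷ +x₀ ∷ -x₀ ∷ +x₁ ∷ -x₂ ∷ -x₃ ∷ +x₀ ∷ -x₀ ∷ +x₀ ∷ -x₀ ∷ +x₀ ∷ -x₀ ∷ -x₀ ∷ -x₀ ∷ +x₀ ∷ -x₁ ∷ +x₂ ∷ +x₃ ∷ -x₀ ∷ +x₀ ∷ -x₀ ∷ +x₀ ∷ -x₀ ∷ [])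
    ∷ (+x₀ ∷ -x₀ ∷ -x₀ ∷ -x₀ ∷ +x₂ ∷ +x₁ ∷ +x₀ ∷ +x₃ ∷ +x₀ ∷ +x₀ ∷ +x₀ ∷ +x₀ ∷ -x₀ ∷ +x₀ ∷ +x₀ ∷ +x₀ ∷ -x₂ ∷ -x₁ ∷ -x₀ ∷ -x₃ ∷ -x₀ ∷ -x₀ ∷ -x₀ ∷ -x₀ ∷ [])
    ∷ (+x₀ ∷ +x₀ ∷ -x₀ ∷ +x₀ ∷ +x₃ ∷ -x₀ ∷ +x₁ ∷ -x₂ ∷ -x₀ ∷ -x₀ ∷ +x₀ ∷ +x₀ ∷ -x₀ ∷ -x₀ ∷ +x₀ ∷ -x₀ ∷ -x₃ ∷ +x₀ ∷ -x₁ ∷ +x₂ ∷ +x₀ ∷ +x₀ ∷ -x₀ ∷ -x₀ ∷ [])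
    ∷ (+x₀ ∷ -x₀ ∷ +x₀ ∷ +x₀ ∷ -x₀ ∷ -x₃ ∷ +x₂ ∷ +x₁ ∷ -x₀ ∷ +x₀ ∷ +x₀ ∷ -x₀ ∷ -x₀ ∷ +x₀ ∷ -x₀ ∷ -x₀ ∷ +x₀ ∷ +x₃ ∷ -x₂ ∷ -x₁ ∷ +x₀ ∷ -x₀ ∷ -x₀ ∷ +x₀ ∷ [])
    ∷ (-x₀ ∷ -x₀ ∷ +x₀ ∷ +x₀ ∷ +x₀ ∷ -x₀ ∷ +x₀ ∷ +x₀ ∷ +x₁ ∷ -x₂ ∷ -x₃ ∷ +x₀ ∷ +x₀ ∷ +x₀ ∷ -x₀ ∷ -x₀ ∷ -x₀ ∷ +x₀ ∷ -x₀ ∷ -x₀ ∷ -x₁ ∷ +x₂ ∷ +x₃ ∷ -x₀ ∷ [])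
    ∷ (-x₀ ∷ +x₀ ∷ +x₀ ∷ -x₀ ∷ -x₀ ∷ -x₀ ∷ +x₀ ∷ -x₀ ∷ +x₂ ∷ +x₁ ∷ +x₀ ∷ +x₃ ∷ +x₀ ∷ -x₀ ∷ -x₀ ∷ +x₀ ∷ +x₀ ∷ +x₀ ∷ -x₀ ∷ +x₀ ∷ -x₂ ∷ -x₁ ∷ -x₀ ∷ -x₃ ∷ [])
    ∷ (+x₀ ∷ -x₀ ∷ +x₀ ∷ -x₀ ∷ +x₀ ∷ -x₀ ∷ -x₀ ∷ -x₀ ∷ +x₃ ∷ -x₀ ∷ +x₁ ∷ -x₂ ∷ -x₀ ∷ +x₀ ∷ -x₀ ∷ +x₀ ∷ -x₀ ∷ +x₀ ∷ +x₀ ∷ +x₀ ∷ -x₃ ∷ +x₀ ∷ -x₁ ∷ +x₂ ∷ [])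
    ∷ (-x₀ ∷ -x₀ ∷ -x₀ ∷ -x₀ ∷ -x₀ ∷ -x₀ ∷ -x₀ ∷ +x₀ ∷ -x₀ ∷ -x₃ ∷ +x₂ ∷ +x₁ ∷ +x₀ ∷ +x₀ ∷ +x₀ ∷ +x₀ ∷ +x₀ ∷ +x₀ ∷ +x₀ ∷ -x₀ ∷ +x₀ ∷ +x₃ ∷ -x₂ ∷ -x₁ ∷ [])
    ∷ [])

D₂₄ : Design 24 4
D₂₄ = fromRows (
    (+x₀ ∷ +x₁ ∷ +x₂ ∷ +x₃ ∷ -x₃ ∷ -x₃ ∷ -x₃ ∷ -x₃ ∷ +x₃ ∷ +x₃ ∷ -x₃ ∷ +x₃ ∷ -x₀ ∷ -x₁ ∷ -x₂ ∷ -x₃ ∷ +x₃ ∷ +x₃ ∷ +x₃ ∷ +x₃ ∷ -x₃ ∷ -x₃ ∷ +x₃ ∷ -x₃ ∷ [])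
    ∷ (+x₁ ∷ -x₀ ∷ +x₃ ∷ -x₂ ∷ -x₃ ∷ +x₃ ∷ -x₃ ∷ +x₃ ∷ +x₃ ∷ -x₃ ∷ +x₃ ∷ +x₃ ∷ -x₁ ∷ +x₀ ∷ -x₃ ∷ +x₂ ∷ +x₃ ∷ -x₃ ∷ +x₃ ∷ -x₃ ∷ -x₃ ∷ +x₃ ∷ -x₃ ∷ -x₃ ∷ [])
    ∷ (+x₂ ∷ -x₃ ∷ -x₀ ∷ +x₁ ∷ -x₃ ∷ +x₃ ∷ +x₃ ∷ -x₃ ∷ -x₃ ∷ -x₃ ∷ -x₃ ∷ +x₃ ∷ -x₂ ∷ +x₃ ∷ +x₀ ∷ -x₁ ∷ +x₃ ∷ -x₃ ∷ -x₃ ∷ +x₃ ∷ +x₃ ∷ +x₃ ∷ +x₃ ∷ -x₃ ∷ [])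
    ∷ (-x₃ ∷ -x₂ ∷ +x₁ ∷ +x₀ ∷ +x₃ ∷ +x₃ ∷ -x₃ ∷ -x₃ ∷ -x₃ ∷ +x₃ ∷ +x₃ ∷ +x₃ ∷ +x₃ ∷ +x₂ ∷ -x₁ ∷ -x₀ ∷ -x₃ ∷ -x₃ ∷ +x₃ ∷ +x₃ ∷ +x₃ ∷ -x₃ ∷ -x₃ ∷ -x₃ ∷ [])
    ∷ (+x₃ ∷ +x₃ ∷ +x₃ ∷ -x₃ ∷ +x₂ ∷ +x₀ ∷ +x₁ ∷ +x₃ ∷ -x₃ ∷ +x₃ ∷ -x₃ ∷ +x₃ ∷ -x₃ ∷ -x₃ ∷ -x₃ ∷ +x₃ ∷ -x₂ ∷ -x₀ ∷ -x₁ ∷ -x₃ ∷ +x₃ ∷ -x₃ ∷ +x₃ ∷ -x₃ ∷ [])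
    ∷ (+x₃ ∷ -x₃ ∷ -x₃ ∷ -x₃ ∷ +x₀ ∷ -x₂ ∷ +x₃ ∷ -x₁ ∷ +x₃ ∷ +x₃ ∷ +x₃ ∷ +x₃ ∷ -x₃ ∷ +x₃ ∷ +x₃ ∷ +x₃ ∷ -x₀ ∷ +x₂ ∷ -x₃ ∷ +x₁ ∷ -x₃ ∷ -x₃ ∷ -x₃ ∷ -x₃ ∷ [])
    ∷ (+x₃ ∷ +x₃ ∷ -x₃ ∷ +x₃ ∷ +x₁ ∷ -x₃ ∷ -x₂ ∷ +x₀ ∷ -x₃ ∷ -x₃ ∷ +x₃ ∷ +x₃ ∷ -x₃ ∷ -x₃ ∷ +x₃ ∷ -x₃ ∷ -x₁ ∷ +x₃ ∷ +x₂ ∷ -x₀ ∷ +x₃ ∷ +x₃ ∷ -x₃ ∷ -x₃ ∷ [])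
    ∷ (+x₃ ∷ -x₃ ∷ +x₃ ∷ +x₃ ∷ -x₃ ∷ -x₁ ∷ +x₀ ∷ +x₂ ∷ -x₃ ∷ +x₃ ∷ +x₃ ∷ -x₃ ∷ -x₃ ∷ +x₃ ∷ -x₃ ∷ -x₃ ∷ +x₃ ∷ +x₁ ∷ -x₀ ∷ -x₂ ∷ +x₃ ∷ -x₃ ∷ -x₃ ∷ +x₃ ∷ [])
    ∷ (-x₃ ∷ -x₃ ∷ +x₃ ∷ +x₃ ∷ +x₃ ∷ -x₃ ∷ +x₃ ∷ +x₃ ∷ +x₁ ∷ -x₂ ∷ -x₀ ∷ +x₃ ∷ +x₃ ∷ +x₃ ∷ -x₃ ∷ -x₃ ∷ -x₃ ∷ +x₃ ∷ -x₃ ∷ -x₃ ∷ -x₁ ∷ +x₂ ∷ +x₀ ∷ -x₃ ∷ [])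
    ∷ (-x₃ ∷ +x₃ ∷ +x₃ ∷ -x₃ ∷ -x₃ ∷ -x₃ ∷ +x₃ ∷ -x₃ ∷ -x₂ ∷ -x₁ ∷ +x₃ ∷ +x₀ ∷ +x₃ ∷ -x₃ ∷ -x₃ ∷ +x₃ ∷ +x₃ ∷ +x₃ ∷ -x₃ ∷ +x₃ ∷ +x₂ ∷ +x₁ ∷ -x₃ ∷ -x₀ ∷ [])
    ∷ (+x₃ ∷ -x₃ ∷ +x₃ ∷ -x₃ ∷ +x₃ ∷ -x₃ ∷ -x₃ ∷ -x₃ ∷ -x₀ ∷ -x₃ ∷ -x₁ ∷ -x₂ ∷ -x₃ ∷ +x₃ ∷ -x₃ ∷ +x₃ ∷ -x₃ ∷ +x₃ ∷ +x₃ ∷ +x₃ ∷ +x₀ ∷ +x₃ ∷ +x₁ ∷ +x₂ ∷ [])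
    ∷ (-x₃ ∷ -x₃ ∷ -x₃ ∷ -x₃ ∷ -x₃ ∷ -x₃ ∷ -x₃ ∷ +x₃ ∷ -x₃ ∷ +x₀ ∷ -x₂ ∷ +x₁ ∷ +x₃ ∷ +x₃ ∷ +x₃ ∷ +x₃ ∷ +x₃ ∷ +x₃ ∷ +x₃ ∷ -x₃ ∷ +x₃ ∷ -x₀ ∷ +x₂ ∷ -x₁ ∷ [])
    ∷ (+x₀ ∷ +x₁ ∷ +x₂ ∷ -x₃ ∷ +x₃ ∷ +x₃ ∷ +x₃ ∷ +x₃ ∷ -x₃ ∷ -x₃ ∷ +x₃ ∷ -x₃ ∷ +x₀ ∷ +x₁ ∷ +x₂ ∷ -x₃ ∷ +x₃ ∷ +x₃ ∷ +x₃ ∷ +x₃ ∷ -x₃ ∷ -x₃ ∷ +x₃ ∷ -x₃ ∷ [])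
    ∷ (+x₁ ∷ -x₀ ∷ -x₃ ∷ -x₂ ∷ +x₃ ∷ -x₃ ∷ +x₃ ∷ -x₃ ∷ -x₃ ∷ +x₃ ∷ -x₃ ∷ -x₃ ∷ +x₁ ∷ -x₀ ∷ -x₃ ∷ -x₂ ∷ +x₃ ∷ -x₃ ∷ +x₃ ∷ -x₃ ∷ -x₃ ∷ +x₃ ∷ -x₃ ∷ -x₃ ∷ [])
    ∷ (+x₂ ∷ +x₃ ∷ -x₀ ∷ +x₁ ∷ +x₃ ∷ -x₃ ∷ -x₃ ∷ +x₃ ∷ +x₃ ∷ +x₃ ∷ +x₃ ∷ -x₃ ∷ +x₂ ∷ +x₃ ∷ -x₀ ∷ +x₁ ∷ +x₃ ∷ -x₃ ∷ -x₃ ∷ +x₃ ∷ +x₃ ∷ +x₃ ∷ +x₃ ∷ -x₃ ∷ [])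
    ∷ (+x₃ ∷ -x₂ ∷ +x₁ ∷ +x₀ ∷ -x₃ ∷ -x₃ ∷ +x₃ ∷ +x₃ ∷ +x₃ ∷ -x₃ ∷ -x₃ ∷ -x₃ ∷ +x₃ ∷ -x₂ ∷ +x₁ ∷ +x₀ ∷ -x₃ ∷ -x₃ ∷ +x₃ ∷ +x₃ ∷ +x₃ ∷ -x₃ ∷ -x₃ ∷ -x₃ ∷ [])
    ∷ (-x₃ ∷ -x₃ ∷ -x₃ ∷ +x₃ ∷ +x₂ ∷ +x₀ ∷ +x₁ ∷ -x₃ ∷ +x₃ ∷ -x₃ ∷ +x₃ ∷ -x₃ ∷ -x₃ ∷ -x₃ ∷ -x₃ ∷ +x₃ ∷ +x₂ ∷ +x₀ ∷ +x₁ ∷ -x₃ ∷ +x₃ ∷ -x₃ ∷ +x₃ ∷ -x₃ ∷ [])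
    ∷ (-x₃ ∷ +x₃ ∷ +x₃ ∷ +x₃ ∷ +x₀ ∷ -x₂ ∷ -x₃ ∷ -x₁ ∷ -x₃ ∷ -x₃ ∷ -x₃ ∷ -x₃ ∷ -x₃ ∷ +x₃ ∷ +x₃ ∷ +x₃ ∷ +x₀ ∷ -x₂ ∷ -x₃ ∷ -x₁ ∷ -x₃ ∷ -x₃ ∷ -x₃ ∷ -x₃ ∷ [])
    ∷ (-x₃ ∷ -x₃ ∷ +x₃ ∷ -x₃ ∷ +x₁ ∷ +x₃ ∷ -x₂ ∷ +x₀ ∷ +x₃ ∷ +x₃ ∷ -x₃ ∷ -x₃ ∷ -x₃ ∷ -x₃ ∷ +x₃ ∷ -x₃ ∷ +x₁ ∷ +x₃ ∷ -x₂ ∷ +x₀ ∷ +x₃ ∷ +x₃ ∷ -x₃ ∷ -x₃ ∷ [])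
    ∷ (-x₃ ∷ +x₃ ∷ -x₃ ∷ -x₃ ∷ +x₃ ∷ -x₁ ∷ +x₀ ∷ +x₂ ∷ +x₃ ∷ -x₃ ∷ -x₃ ∷ +x₃ ∷ -x₃ ∷ +x₃ ∷ -x₃ ∷ -x₃ ∷ +x₃ ∷ -x₁ ∷ +x₀ ∷ +x₂ ∷ +x₃ ∷ -x₃ ∷ -x₃ ∷ +x₃ ∷ [])
    ∷ (+x₃ ∷ +x₃ ∷ -x₃ ∷ -x₃ ∷ -x₃ ∷ +x₃ ∷ -x₃ ∷ -x₃ ∷ +x₁ ∷ -x₂ ∷ -x₀ ∷ -x₃ ∷ +x₃ ∷ +x₃ ∷ -x₃ ∷ -x₃ ∷ -x₃ ∷ +x₃ ∷ -x₃ ∷ -x₃ ∷ +x₁ ∷ -x₂ ∷ -x₀ ∷ -x₃ ∷ [])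
    ∷ (+x₃ ∷ -x₃ ∷ -x₃ ∷ +x₃ ∷ +x₃ ∷ +x₃ ∷ -x₃ ∷ +x₃ ∷ -x₂ ∷ -x₁ ∷ -x₃ ∷ +x₀ ∷ +x₃ ∷ -x₃ ∷ -x₃ ∷ +x₃ ∷ +x₃ ∷ +x₃ ∷ -x₃ ∷ +x₃ ∷ -x₂ ∷ -x₁ ∷ -x₃ ∷ +x₀ ∷ [])
    ∷ (-x₃ ∷ +x₃ ∷ -x₃ ∷ +x₃ ∷ -x₃ ∷ +x₃ ∷ +x₃ ∷ +x₃ ∷ -x₀ ∷ +x₃ ∷ -x₁ ∷ -x₂ ∷ -x₃ ∷ +x₃ ∷ -x₃ ∷ +x₃ ∷ -x₃ ∷ +x₃ ∷ +x₃ ∷ +x₃ ∷ -x₀ ∷ +x₃ ∷ -x₁ ∷ -x₂ ∷ [])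
    ∷ (+x₃ ∷ +x₃ ∷ +x₃ ∷ +x₃ ∷ +x₃ ∷ +x₃ ∷ +x₃ ∷ -x₃ ∷ +x₃ ∷ +x₀ ∷ -x₂ ∷ +x₁ ∷ +x₃ ∷ +x₃ ∷ +x₃ ∷ +x₃ ∷ +x₃ ∷ +x₃ ∷ +x₃ ∷ -x₃ ∷ +x₃ ∷ +x₀ ∷ -x₂ ∷ +x₁ ∷ [])
    ∷ [])

aod₁₆ : FullAOD′ 16 (lookup (10 ∷ 2 ∷ 2 ∷ 2 ∷ [])) (lookup (2 ∷ 2 ∷ 2 ∷ 10 ∷ []))
aod₁₆ = fullAOD′-byEvaluation _ _ C₁₆ D₁₆

aod₂₄ : FullAOD′ 24 (lookup (18 ∷ 2 ∷ 2 ∷ 2 ∷ [])) (lookup (2 ∷ 2 ∷ 2 ∷ 18 ∷ []))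
aod₂₄ = fullAOD′-byEvaluation _ _ C₂₄ D₂₄

lookup-map-applyUpTo : ∀ (g f : ℕ → ℕ) n (i : Fin (length (map g (applyUpTo f n)))) →
                       lookup (map g (applyUpTo f n)) i ≡ g (f (toℕ i))
lookup-map-applyUpTo g f (suc n) zero    = refl
lookup-map-applyUpTo g f (suc n) (suc i) = lookup-map-applyUpTo g (f ∘ suc) n i

length-geomTail : ∀ b t → length (geomTail b (suc t)) ≡ t
length-geomTail b t = trans (ListP.length-map (λ j → b * 2 ^ j) (applyUpTo (λ j → suc (suc j)) t))
                            (ListP.length-applyUpTo (λ j → suc (suc j)) t)

lookup-geomTail : ∀ b t i → lookup (geomTail b (suc t)) i ≡ b * 2 ^ (2 + toℕ i)
lookup-geomTail b t = lookup-map-applyUpTo (λ j → b * 2 ^ j) (λ j → suc (suc j)) t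

extendByDoubling :
  ∀ {m} b → FullAOD′ m (lookup (2 * b ∷ 2 ∷ 2 ∷ 2 ∷ [])) (lookup (2 ∷ 2 ∷ 2 ∷ 2 * b ∷ [])) → ∀ t →
  FullAOD (m * 2 ^ suc t) (2 ^ (2 + t) ∷ 2 ^ (2 + t) ∷ 2 ^ (2 + t) ∷ 2 * b ∷ 2 * b ∷ geomTail b (suc t))
                          (2 ^ (2 + t) ∷ 2 ^ (2 + t) ∷ 2 ^ (2 + t) ∷ b * 2 ^ (2 + t) ∷ [])
extendByDoubling b A t = toFullAOD (aodProduct σ A (doublingAOD t) αWeights βWeights dWeights)
  where
  cs : List ℕ
  cs = 2 ^ (2 + t) ∷ 2 ^ (2 + t) ∷ 2 ^ (2 + t) ∷ 2 * b ∷ 2 * b ∷ geomTail b (suc t)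

  σ : Fin (length cs) ↔ (Fin 3 ⊎ Fin (2 + t))
  σ = ↔-trans (cast-id (cong (λ n → 5 + n) (length-geomTail b t))) +↔⊎

  double : ∀ x → 2 * b * x ≡ b * (2 * x)
  double x = trans (cong (_* x) (ℕP.*-comm 2 b)) (ℕP.*-assoc b 2 x)

  αWeights : ∀ a → lookup (2 * b ∷ 2 ∷ 2 ∷ 2 ∷ []) (suc a) * 2 ^ suc t ≡ lookup cs (Inverse.from σ (inj₁ a))
  αWeights zero             = refl
  αWeights (suc zero)       = refl
  αWeights (suc (suc zero)) = refl

  βWeights : ∀ s → 2 * b * doublingWeight (toℕ s) ≡ lookup cs (Inverse.from σ (inj₂ s))
  βWeights zero          = ℕP.*-identityʳ (2 * b)
  βWeights (suc zero)    = ℕP.*-identityʳ (2 * b)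
  βWeights (suc (suc s)) = begin
    2 * b * 2 ^ suc (toℕ s)                 ≡⟨ double (2 ^ suc (toℕ s)) ⟩
    b * 2 ^ (2 + toℕ s)                     ≡⟨ cong (λ j → b * 2 ^ (2 + j)) (toℕ-cast _ s) ⟨
    b * 2 ^ (2 + toℕ (cast _ s))            ≡⟨ lookup-geomTail b t _ ⟨
    lookup (geomTail b (suc t)) (cast _ s)  ∎

  dWeights : ∀ i → lookup (2 ∷ 2 ∷ 2 ∷ 2 * b ∷ []) i * 2 ^ suc t
                   ≡ lookup (2 ^ (2 + t) ∷ 2 ^ (2 + t) ∷ 2 ^ (2 + t) ∷ b * 2 ^ (2 + t) ∷ []) i
  dWeights zero                   = refl
  dWeights (suc zero)             = refl
  dWeights (suc (suc zero))       = refl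
  dWeights (suc (suc (suc zero))) = double (2 ^ suc t)

fullAOD-2^n : (n : ℕ) → n > 4 →
  FullAOD (2 ^ n)
    (2 ^ (n ∸ 3) ∷ 2 ^ (n ∸ 3) ∷ 2 ^ (n ∸ 3) ∷ 10 ∷ 10 ∷ geomTail 5 (n ∸ 4))
    (2 ^ (n ∸ 3) ∷ 2 ^ (n ∸ 3) ∷ 2 ^ (n ∸ 3) ∷ 5 * 2 ^ (n ∸ 3) ∷ [])
fullAOD-2^n _ (s≤s (s≤s (s≤s (s≤s (s≤s {n = t} _))))) =
  resize (sym (ℕP.^-distribˡ-+-* 2 4 (suc t))) (extendByDoubling 5 aod₁₆ t)

fullAOD-3·2^n : (n : ℕ) → n > 3 →
  FullAOD (3 * 2 ^ n)
    (2 ^ (n ∸ 2) ∷ 2 ^ (n ∸ 2) ∷ 2 ^ (n ∸ 2) ∷ 18 ∷ 18 ∷ geomTail 9 (n ∸ 3))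
    (2 ^ (n ∸ 2) ∷ 2 ^ (n ∸ 2) ∷ 2 ^ (n ∸ 2) ∷ 9 * 2 ^ (n ∸ 2) ∷ [])
fullAOD-3·2^n _ (s≤s (s≤s (s≤s (s≤s {n = t} _)))) =
  resize order (extendByDoubling 9 aod₂₄ t)
  where
  order : 24 * 2 ^ suc t ≡ 3 * 2 ^ (3 + suc t)
  order = trans (ℕP.*-assoc 3 8 (2 ^ suc t)) (cong (3 *_) (sym (ℕP.^-distribˡ-+-* 2 3 (suc t))))

mainTheorem4 :
    ((n : ℕ) → n > 4 →
      FullAOD (2 ^ n)
        (2 ^ (n ∸ 3) ∷ 2 ^ (n ∸ 3) ∷ 2 ^ (n ∸ 3) ∷ 10 ∷ 10 ∷ geomTail 5 (n ∸ 4))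
        (2 ^ (n ∸ 3) ∷ 2 ^ (n ∸ 3) ∷ 2 ^ (n ∸ 3) ∷ 5 * 2 ^ (n ∸ 3) ∷ []))
    ×
    ((n : ℕ) → n > 3 →
      FullAOD (3 * 2 ^ n)
        (2 ^ (n ∸ 2) ∷ 2 ^ (n ∸ 2) ∷ 2 ^ (n ∸ 2) ∷ 18 ∷ 18 ∷ geomTail 9 (n ∸ 3))
        (2 ^ (n ∸ 2) ∷ 2 ^ (n ∸ 2) ∷ 2 ^ (n ∸ 2) ∷ 9 * 2 ^ (n ∸ 2) ∷ []))
mainTheorem4 = fullAOD-2^n , fullAOD-3·2^n
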